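{- For $1\le k\le n$ let $\mathcal{S}_n^{k\mapsto1}(231,3124)$ be the set of $\sigma\in\mathcal{S}_n(231,3124)$ with $\sigma(k)=1$. For $1\le k<n$, \[ \bigl|\mathcal{S}_n^{k\mapsto1}(231,3124)\bigr| = k\cdot\bigl|\mathcal{S}_{n-k}(231,3124)\bigr|, \] and the generating function $g(x,t)=\sum_{n\ge1}\sum_{k=1}^n \bigl|\mathcal{S}_n^{k\mapsto1}(231,3124)\bigr| t^kx^n$ satisfies \[ g(x,t) = \frac{tx}{1-tx} + \frac{tx}{(1-tx)^2}\cdot \frac{x-x^2}{1-3x+x^2}. \]
   Context: Permutations of $[n]$ are written in one-line notation. A permutation $\sigma$ contains a pattern $\tau\in\mathcal{S}_k$ if it has a subsequence $\sigma(i_1),\dots,\sigma(i_k)$ ($i_1<\dots<i_k$) in the same relative order as $\tau$; $\mathcal{S}_n(231,3124)$ is the set of permutations of $[n]$ avoiding both $231$ and $3124$. -}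

module Defs where

open import Data.Bool using (Bool; true; false; _∧_; _∨_; not; if_then_else_)
open import Data.Nat using (ℕ; zero; suc; _+_; _*_; _∸_; _≤ᵇ_; _<ᵇ_; _≡ᵇ_)
open import Data.List using (List; []; _∷_; map; concatMap; length; filterᵇ; all; any; upTo; sum)
open import Data.Integer as ℤ using (ℤ; +_)

-- Permutations of [n] in one-line notation: lists σ(1) … σ(n) of length n
-- with entries in {1,…,n}, pairwise distinct.

words : ℕ → ℕ → List (List ℕ)
words m zero    = [] ∷ []
words m (suc n) = concatMap (λ w → map (λ a → a ∷ w) (map suc (upTo m))) (words m n)

distinct : List ℕ → Bool
distinct []       = true
distinct (a ∷ w)  = all (λ b → not (a ≡ᵇ b)) w ∧ distinct w

perms : ℕ → List (List ℕ)
perms n = filterᵇ distinct (words n n)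

subseqs : List ℕ → List (List ℕ)
subseqs []      = [] ∷ []
subseqs (a ∷ w) = map (a ∷_) (subseqs w) Data.List.++ subseqs w

sameOrder : List ℕ → List ℕ → Bool
sameOrder []      []      = true
sameOrder []      (_ ∷ _) = false
sameOrder (_ ∷ _) []      = false
sameOrder (a ∷ u) (b ∷ v) = agree a b u v ∧ sameOrder u v
  where
  agree : ℕ → ℕ → List ℕ → List ℕ → Bool
  agree a b []      []      = true
  agree a b (c ∷ u) (d ∷ v) = not ((a <ᵇ c) Data.Bool.xor (b <ᵇ d)) ∧ agree a b u v
  agree a b _       _       = false

contains : List ℕ → List ℕ → Bool
contains σ τ = any (sameOrder τ) (subseqs σ)

avoids : List ℕ → List ℕ → Bool
avoids σ τ = not (contains σ τ)

avoids231-3124 : List ℕ → Bool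
avoids231-3124 σ = avoids σ (2 ∷ 3 ∷ 1 ∷ []) ∧ avoids σ (3 ∷ 1 ∷ 2 ∷ 4 ∷ [])

-- σ(k) (1-indexed); 0 if out of range
at : List ℕ → ℕ → ℕ
at []      _             = 0
at (a ∷ w) zero          = 0
at (a ∷ w) (suc zero)    = a
at (a ∷ w) (suc (suc k)) = at w (suc k)

count : ℕ → ℕ
count n = length (filterᵇ avoids231-3124 (perms n))

countK1 : ℕ → ℕ → ℕ
countK1 n k = length (filterᵇ (λ σ → avoids231-3124 σ ∧ (at σ k ≡ᵇ 1)) (perms n))

-- Formal power series in two variables x, t with integer coefficients:
-- s i j is the coefficient of x^i t^j.

Series : Set
Series = ℕ → ℕ → ℤ

_≈ₛ_ : Series → Series → Set
f ≈ₛ g = ∀ i j → f i j Eq.≡ g i j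
  where import Relation.Binary.PropositionalEquality as Eq
infix 4 _≈ₛ_

_+ₛ_ : Series → Series → Series
(f +ₛ g) i j = f i j ℤ.+ g i j

_-ₛ_ : Series → Series → Series
(f -ₛ g) i j = f i j ℤ.- g i j

sumℤ : List ℤ → ℤ
sumℤ []      = + 0
sumℤ (z ∷ l) = z ℤ.+ sumℤ l

_*ₛ_ : Series → Series → Series
(f *ₛ g) i j = sumℤ (concatMap (λ a → map (λ b → f a b ℤ.* g (i ∸ a) (j ∸ b)) (upTo (suc j))) (upTo (suc i)))

infixl 6 _+ₛ_ _-ₛ_
infixl 7 _*ₛ_

mono : ℤ → ℕ → ℕ → Series
mono c a b i j = if (i ≡ᵇ a) ∧ (j ≡ᵇ b) then c else + 0

oneₛ xₛ tₛ : Series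
oneₛ = mono (+ 1) 0 0
xₛ   = mono (+ 1) 1 0
tₛ   = mono (+ 1) 0 1

gSeries : Series
gSeries n k = if (1 ≤ᵇ k) ∧ (k ≤ᵇ n) then + countK1 n k else + 0

module Submission where

-- If σ ∈ S_n(231,3124) has σ(k) = 1 with k < n, avoiding 231 makes the entries before the 1 decrease, and
-- avoiding 231 and 3124 puts each of them either above or below everything after the 1.  Counting values then
-- shows σ = n, n−1, …, n−j+1, d, …, 2, 1, τ+d with j + d = k and τ ∈ S_{n−k}(231,3124), and every such word
-- avoids both patterns; the pairs (j, τ) with j < k give the first formula.  Summing over the position of the 1
-- gives c(m+1) = 1 + Σ_{i<m} (i+1) c(m−i) for c(n) = |S_n(231,3124)|, hence c(m+3) + c(m+1) = 3 c(m+2).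
-- The generating function is compared coefficientwise: the hypotheses force u = Σ (tx)^i and v = Σ f_i x^i,
-- where f_i = F_{2i+2} are the coefficients of 1/(1−3x+x²).  The coefficient of x^i t^j on the right is then
-- [1 ≤ j = i] + j (f_{i−j−1} − f_{i−j−2}), terms with negative index being 0, and f_{m−1} − f_{m−2} = c(m)
-- because both sides satisfy the same recurrence.

module Permutations where

  open import Defs
  open import Data.Bool using (Bool; true; false; T; T?; _∧_; not)
  open import Data.Bool.Properties using (T-∧; T-≡; T-not-≡; ¬-not)
  open import Data.Unit using (tt)
  open import Data.Nat as ℕ
    using (ℕ; zero; suc; _+_; _*_; _∸_; _≤_; _<_; _>_; z≤n; s≤s; s≤s⁻¹; _≡ᵇ_; _<ᵇ_; _≟_; _≤?_; _<?_)
  open import Data.Nat.Properties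
  open import Data.Nat.Tactic.RingSolver using (solve-∀)
  open import Data.List
    using (List; []; _∷_; _++_; [_]; map; concatMap; length; filterᵇ; upTo; take; drop; cartesianProduct)
  open import Data.List.Properties
    using (∷-injective; ∷-injectiveˡ; length-map; length-++; length-upTo; ++-assoc; ++-identityʳ; filter-all; filter-none; filter-++)
  open import Data.List.Membership.Propositional using (_∈_; find; lose)
  open import Data.List.Membership.Propositional.Properties
  open import Data.List.Relation.Unary.Any using (here; there)
  open import Data.List.Relation.Unary.Any.Properties using (any⁺; any⁻)
  open import Data.List.Relation.Unary.All as All using (All; []; _∷_)
  open import Data.List.Relation.Unary.All.Properties as All using (all⁺; all⁻; anti-mono)
  open import Data.List.Relation.Unary.AllPairs as AllPairs using (AllPairs; []; _∷_)
  import Data.List.Relation.Unary.AllPairs.Properties as AllPairs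
  open import Data.List.Relation.Unary.Unique.Propositional using (Unique)
  import Data.List.Relation.Unary.Unique.Propositional.Properties as Unique
  open import Data.List.Relation.Binary.Sublist.Propositional as Sublist using (_⊆_; []; _∷_; _∷ʳ_; ⊆-refl; ⊆-trans)
  open import Data.List.Relation.Binary.Sublist.Propositional.Properties using (map⁺; ++⁺; ++⁺ˡ; ++⁺ʳ; []⊆-universal; ∷ˡ⁻)
  open import Data.Product using (∃; ∃₂; _×_; _,_; proj₁; proj₂)
  open import Data.Sum using (_⊎_; inj₁; inj₂)
  open import Function using (_∘_; _∋_; _⇔_; mk⇔; Equivalence)
  open import Relation.Nullary using (¬_; yes; no; contradiction)
  open import Relation.Binary.PropositionalEquality hiding ([_])
  open import Relation.Binary.Definitions using (tri<; tri≈; tri>)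
  open import Data.List.Membership.DecPropositional _≟_ using (_∈?_)

  private
    variable
      A C : Set

  length-≤-of-Unique-⊆ : {xs ys : List A} → Unique xs → (∀ {x} → x ∈ xs → x ∈ ys) → length xs ≤ length ys
  length-≤-of-Unique-⊆ {xs = []} _ _ = z≤n
  length-≤-of-Unique-⊆ {xs = x ∷ xs} {ys} (x∉xs ∷ u) xs⊆ys with ∈-∃++ (xs⊆ys (here refl))
  ... | ys₁ , ys₂ , refl = begin
    suc (length xs)          ≤⟨ s≤s (length-≤-of-Unique-⊆ u xs⊆ys₁++ys₂) ⟩
    suc (length (ys₁ ++ ys₂)) ≡⟨ cong suc (length-++ ys₁) ⟩
    suc (length ys₁ + length ys₂) ≡⟨ +-suc (length ys₁) (length ys₂) ⟨
    length ys₁ + suc (length ys₂) ≡⟨ length-++ ys₁ ⟨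
    length (ys₁ ++ x ∷ ys₂)  ∎
    where
    open ≤-Reasoning
    remove : ∀ {y} → y ∈ ys₁ ++ x ∷ ys₂ → y ≢ x → y ∈ ys₁ ++ ys₂
    remove {y} y∈ y≢x with ∈-++⁻ ys₁ y∈
    ... | inj₁ y∈ys₁ = ∈-++⁺ˡ y∈ys₁
    ... | inj₂ (here y≡x) = contradiction y≡x y≢x
    ... | inj₂ (there y∈ys₂) = ∈-++⁺ʳ ys₁ y∈ys₂
    xs⊆ys₁++ys₂ : ∀ {y} → y ∈ xs → y ∈ ys₁ ++ ys₂
    xs⊆ys₁++ys₂ y∈xs = remove (xs⊆ys (there y∈xs)) (λ y≡x → All.lookup x∉xs y∈xs (sym y≡x))

  Unique-map-retract : {xs : List A} (f : A → C) (g : C → A) → (∀ {x} → x ∈ xs → g (f x) ≡ x) →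
                       Unique xs → Unique (map f xs)
  Unique-map-retract f g gf [] = []
  Unique-map-retract {xs = x ∷ xs} f g gf (x∉xs ∷ u) =
    All.map⁺ (All.tabulate λ {y} y∈xs fx≡fy → All.lookup x∉xs y∈xs (begin
        x         ≡⟨ gf (here refl) ⟨
        g (f x)   ≡⟨ cong g fx≡fy ⟩
        g (f y)   ≡⟨ gf (there y∈xs) ⟩
        y         ∎))
    ∷ Unique-map-retract f g (gf ∘ there) u
    where open ≡-Reasoning

  length-≡-of-bijection : {xs : List A} {ys : List C} → Unique xs → Unique ys → (f : A → C) (g : C → A) →
    (∀ {x} → x ∈ xs → f x ∈ ys) → (∀ {y} → y ∈ ys → g y ∈ xs) →
    (∀ {x} → x ∈ xs → g (f x) ≡ x) → (∀ {y} → y ∈ ys → f (g y) ≡ y) → length xs ≡ length ys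
  length-≡-of-bijection {xs = xs} {ys} uxs uys f g f∈ g∈ gf fg = ≤-antisym
    (into uxs f g f∈ gf) (into uys g f g∈ fg)
    where
    into : ∀ {A C : Set} {xs : List A} {ys : List C} → Unique xs → (f : A → C) (g : C → A) →
           (∀ {x} → x ∈ xs → f x ∈ ys) → (∀ {x} → x ∈ xs → g (f x) ≡ x) → length xs ≤ length ys
    into {xs = xs} {ys} u f g f∈ gf = begin
      length xs       ≡⟨ length-map f xs ⟨
      length (map f xs) ≤⟨ length-≤-of-Unique-⊆ (Unique-map-retract f g gf u) image⊆ ⟩
      length ys       ∎
      where
      open ≤-Reasoning
      image⊆ : ∀ {y} → y ∈ map f xs → y ∈ ys
      image⊆ y∈ with ∈-map⁻ f y∈
      ... | x , x∈xs , refl = f∈ x∈xs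

  Unique-concatMap : {xs : List A} (F : A → List C) → Unique xs → (∀ x → Unique (F x)) →
                     (∀ {x y z} → z ∈ F x → z ∈ F y → x ≡ y) → Unique (concatMap F xs)
  Unique-concatMap F [] _ _ = []
  Unique-concatMap {xs = x ∷ xs} F (x∉xs ∷ u) uF disj =
    Unique.++⁺ (uF x) (Unique-concatMap F u uF disj) apart
    where
    apart : ∀ {z} → ¬ (z ∈ F x × z ∈ concatMap F xs)
    apart (z∈Fx , z∈rest) with ∈-concat⁻′ (map F xs) z∈rest
    ... | _ , z∈Fy , Fy∈ with ∈-map⁻ F Fy∈
    ... | y , y∈xs , refl = All.lookup x∉xs y∈xs (disj z∈Fx z∈Fy)

  length-cartesianProduct : (xs : List A) (ys : List C) → length (cartesianProduct xs ys) ≡ length xs * length ys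
  length-cartesianProduct [] ys = refl
  length-cartesianProduct (x ∷ xs) ys = begin
    length (map (x ,_) ys ++ cartesianProduct xs ys)     ≡⟨ length-++ (map (x ,_) ys) ⟩
    length (map (x ,_) ys) + length (cartesianProduct xs ys) ≡⟨ cong₂ _+_ (length-map (x ,_) ys) (length-cartesianProduct xs ys) ⟩
    length ys + length xs * length ys                    ∎
    where open ≡-Reasoning

  ∈-filterᵇ⁺ : (p : A → Bool) {xs : List A} {x : A} → x ∈ xs → T (p x) → x ∈ filterᵇ p xs
  ∈-filterᵇ⁺ p = ∈-filter⁺ (T? ∘ p)

  ∈-filterᵇ⁻ : (p : A → Bool) {xs : List A} {x : A} → x ∈ filterᵇ p xs → x ∈ xs × T (p x)
  ∈-filterᵇ⁻ p = ∈-filter⁻ (T? ∘ p)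

  Unique-filterᵇ : (p : A → Bool) {xs : List A} → Unique xs → Unique (filterᵇ p xs)
  Unique-filterᵇ p = Unique.filter⁺ (T? ∘ p)

  AllPairs-⊆ : ∀ {R : A → A → Set} {u w : List A} → u ⊆ w → AllPairs R w → AllPairs R u
  AllPairs-⊆ [] [] = []
  AllPairs-⊆ (_ ∷ʳ τ) (_ ∷ rw) = AllPairs-⊆ τ rw
  AllPairs-⊆ (refl ∷ τ) (px ∷ rw) = anti-mono (Sublist.lookup τ) px ∷ AllPairs-⊆ τ rw

  ⊆-++-split : ∀ (xs : List A) {ys u} → u ⊆ xs ++ ys → ∃₂ λ u₁ u₂ → u ≡ u₁ ++ u₂ × u₁ ⊆ xs × u₂ ⊆ ys
  ⊆-++-split [] τ = [] , _ , refl , [] , τ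
  ⊆-++-split (x ∷ xs) (.x ∷ʳ τ) with ⊆-++-split xs τ
  ... | u₁ , u₂ , refl , τ₁ , τ₂ = u₁ , u₂ , refl , x ∷ʳ τ₁ , τ₂
  ⊆-++-split (x ∷ xs) (refl ∷ τ) with ⊆-++-split xs τ
  ... | u₁ , u₂ , refl , τ₁ , τ₂ = x ∷ u₁ , u₂ , refl , refl ∷ τ₁ , τ₂

  ⊆-map⁻ : ∀ (f : A → C) (w : List A) {u} → u ⊆ map f w → ∃ λ u′ → u ≡ map f u′ × u′ ⊆ w
  ⊆-map⁻ f [] [] = [] , refl , []
  ⊆-map⁻ f (a ∷ w) (_ ∷ʳ τ) with ⊆-map⁻ f w τ
  ... | u′ , refl , τ′ = u′ , refl , a ∷ʳ τ′
  ⊆-map⁻ f (a ∷ w) (refl ∷ τ) with ⊆-map⁻ f w τ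
  ... | u′ , refl , τ′ = a ∷ u′ , refl , refl ∷ τ′

  InRange : ℕ → ℕ → Set
  InRange n a = 1 ≤ a × a ≤ n

  record IsPerm (n : ℕ) (σ : List ℕ) : Set where
    constructor isPerm
    field
      length≡ : length σ ≡ n
      inRange : All (InRange n) σ
      unique  : Unique σ

  private
    letters : ℕ → List ℕ
    letters m = map suc (upTo m)

    ∈-letters⁺ : ∀ {m a} → InRange m a → a ∈ letters m
    ∈-letters⁺ {a = suc a} (_ , a<m) = ∈-map⁺ suc (∈-upTo⁺ a<m)

    ∈-letters⁻ : ∀ {m a} → a ∈ letters m → InRange m a
    ∈-letters⁻ a∈ with ∈-map⁻ suc a∈
    ... | _ , a<m , refl = s≤s z≤n , ∈-upTo⁻ a<m

    extend : ℕ → List ℕ → List (List ℕ)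
    extend m w = map (_∷ w) (letters m)

  ∈-words⁺ : ∀ m n {w} → length w ≡ n → All (InRange m) w → w ∈ words m n
  ∈-words⁺ m zero {[]} _ _ = here refl
  ∈-words⁺ m (suc n) {a ∷ w} len (a∈ ∷ w∈) =
    ∈-concatMap⁺ (extend m) (lose (∈-words⁺ m n (suc-injective len) w∈) (∈-map⁺ (_∷ w) (∈-letters⁺ a∈)))

  ∈-words⁻ : ∀ m n {w} → w ∈ words m n → length w ≡ n × All (InRange m) w
  ∈-words⁻ m zero (here refl) = refl , []
  ∈-words⁻ m (suc n) w∈ with find (∈-concatMap⁻ (extend m) {xs = words m n} w∈)
  ... | v , v∈ , w∈ext with ∈-map⁻ (_∷ v) w∈ext | ∈-words⁻ m n v∈
  ... | a , a∈ , refl | len , v∈m = cong suc len , ∈-letters⁻ a∈ ∷ v∈m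

  words-Unique : ∀ m n → Unique (words m n)
  words-Unique m zero = [] ∷ []
  words-Unique m (suc n) = Unique-concatMap (extend m) (words-Unique m n)
    (λ w → Unique.map⁺ ∷-injectiveˡ (Unique.map⁺ suc-injective (Unique.upTo⁺ m)))
    same-tail
    where
    same-tail : ∀ {v w z} → z ∈ extend m v → z ∈ extend m w → v ≡ w
    same-tail {v} {w} z∈ z∈′ with ∈-map⁻ (_∷ v) z∈ | ∈-map⁻ (_∷ w) z∈′
    ... | _ , _ , refl | _ , _ , refl = refl

  T-not-≡ᵇ⇒≢ : ∀ {a b} → T (not (a ≡ᵇ b)) → a ≢ b
  T-not-≡ᵇ⇒≢ {a} {b} t a≡b with a ≡ᵇ b | ≡⇒≡ᵇ a b a≡b
  ... | true  | _ = t

  ≢⇒T-not-≡ᵇ : ∀ {a b} → a ≢ b → T (not (a ≡ᵇ b))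
  ≢⇒T-not-≡ᵇ {a} {b} a≢b with a ≡ᵇ b in eq
  ... | false = tt
  ... | true  = a≢b (≡ᵇ⇒≡ a b (subst T (sym eq) tt))

  distinct⇒Unique : ∀ w → T (distinct w) → Unique w
  distinct⇒Unique [] _ = []
  distinct⇒Unique (a ∷ w) t with Equivalence.to T-∧ t
  ... | a∉w , dw = All.map T-not-≡ᵇ⇒≢ (all⁺ _ w a∉w) ∷ distinct⇒Unique w dw

  Unique⇒distinct : ∀ w → Unique w → T (distinct w)
  Unique⇒distinct [] _ = tt
  Unique⇒distinct (a ∷ w) (a∉w ∷ uw) =
    Equivalence.from T-∧ (all⁻ _ (All.map ≢⇒T-not-≡ᵇ a∉w) , Unique⇒distinct w uw)

  ∈-perms⁺ : ∀ n {σ} → IsPerm n σ → σ ∈ perms n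
  ∈-perms⁺ n {σ} (isPerm len rng u) = ∈-filterᵇ⁺ distinct (∈-words⁺ n n len rng) (Unique⇒distinct σ u)

  ∈-perms⁻ : ∀ n {σ} → σ ∈ perms n → IsPerm n σ
  ∈-perms⁻ n {σ} σ∈ with ∈-filterᵇ⁻ distinct σ∈
  ... | σ∈words , dσ with ∈-words⁻ n n σ∈words
  ... | len , rng = isPerm len rng (distinct⇒Unique σ dσ)

  perms-Unique : ∀ n → Unique (perms n)
  perms-Unique n = Unique-filterᵇ distinct (words-Unique n n)

  -- Pattern containment

  ∈-subseqs⁺ : ∀ {u w} → u ⊆ w → u ∈ subseqs w
  ∈-subseqs⁺ [] = here refl
  ∈-subseqs⁺ (_∷ʳ_ {ys = w} a τ) = ∈-++⁺ʳ (map (a ∷_) (subseqs w)) (∈-subseqs⁺ τ)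
  ∈-subseqs⁺ (refl ∷ τ) = ∈-++⁺ˡ (∈-map⁺ (_ ∷_) (∈-subseqs⁺ τ))

  ∈-subseqs⁻ : ∀ w {u} → u ∈ subseqs w → u ⊆ w
  ∈-subseqs⁻ [] (here refl) = []
  ∈-subseqs⁻ (a ∷ w) u∈ with ∈-++⁻ (map (a ∷_) (subseqs w)) u∈
  ... | inj₂ u∈w = a ∷ʳ ∈-subseqs⁻ w u∈w
  ... | inj₁ u∈aw with ∈-map⁻ (a ∷_) u∈aw
  ... | v , v∈ , refl = refl ∷ ∈-subseqs⁻ w v∈

  sameOrder-length : ∀ τ u → T (sameOrder τ u) → length τ ≡ length u
  sameOrder-length [] [] _ = refl
  sameOrder-length (a ∷ τ) (b ∷ u) t = cong suc (sameOrder-length τ u (proj₂ (Equivalence.to T-∧ t)))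

  <ᵇ≡true : ∀ {a b} → a < b → (a <ᵇ b) ≡ true
  <ᵇ≡true a<b = Equivalence.to T-≡ (<⇒<ᵇ a<b)

  <ᵇ≡false : ∀ {a b} → b ≤ a → (a <ᵇ b) ≡ false
  <ᵇ≡false {a} {b} b≤a = ¬-not (λ a<ᵇb → <⇒≱ (<ᵇ⇒< a b (Equivalence.from T-≡ a<ᵇb)) b≤a)

  <ᵇ≡true⇒< : ∀ {a b} → (a <ᵇ b) ≡ true → a < b
  <ᵇ≡true⇒< {a} {b} e = <ᵇ⇒< a b (Equivalence.from T-≡ e)

  <ᵇ≡false⇒≥ : ∀ {a b} → (a <ᵇ b) ≡ false → b ≤ a
  <ᵇ≡false⇒≥ {a} {b} e = ≮⇒≥ (λ a<b → subst T e (<⇒<ᵇ a<b))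

  -- Occurrences as `sameOrder` sees them: it only compares with `<ᵇ`, so ties are allowed at the descents.
  data Is231 : List ℕ → Set where
    is231 : ∀ {a b c} → c ≤ a → a < b → Is231 (a ∷ b ∷ c ∷ [])

  data Is3124 : List ℕ → Set where
    is3124 : ∀ {w x y z} → x < y → y ≤ w → w < z → Is3124 (w ∷ x ∷ y ∷ z ∷ [])

  Is231⇒sameOrder : ∀ {u} → Is231 u → T (sameOrder (2 ∷ 3 ∷ 1 ∷ []) u)
  Is231⇒sameOrder (is231 c≤a a<b)
    rewrite <ᵇ≡true a<b | <ᵇ≡false c≤a | <ᵇ≡false (≤-trans c≤a (<⇒≤ a<b)) = tt

  sameOrder⇒Is231 : ∀ u → T (sameOrder (2 ∷ 3 ∷ 1 ∷ []) u) → Is231 u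
  sameOrder⇒Is231 u t with sameOrder-length (2 ∷ 3 ∷ 1 ∷ []) u t
  sameOrder⇒Is231 (a ∷ b ∷ c ∷ []) t | _ with a <ᵇ b in ab | a <ᵇ c in ac | b <ᵇ c
  ... | true | false | false = is231 (<ᵇ≡false⇒≥ ac) (<ᵇ≡true⇒< ab)

  Is3124⇒sameOrder : ∀ {u} → Is3124 u → T (sameOrder (3 ∷ 1 ∷ 2 ∷ 4 ∷ []) u)
  Is3124⇒sameOrder (is3124 x<y y≤w w<z)
    rewrite <ᵇ≡false (≤-trans (<⇒≤ x<y) y≤w) | <ᵇ≡false y≤w | <ᵇ≡true w<z | <ᵇ≡true x<y
          | <ᵇ≡true (<-≤-trans x<y (≤-trans y≤w (<⇒≤ w<z))) | <ᵇ≡true (≤-<-trans y≤w w<z) = tt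

  sameOrder⇒Is3124 : ∀ u → T (sameOrder (3 ∷ 1 ∷ 2 ∷ 4 ∷ []) u) → Is3124 u
  sameOrder⇒Is3124 u t with sameOrder-length (3 ∷ 1 ∷ 2 ∷ 4 ∷ []) u t
  sameOrder⇒Is3124 (w ∷ x ∷ y ∷ z ∷ []) t | _
    with w <ᵇ x | w <ᵇ y in wy | w <ᵇ z in wz | x <ᵇ y in xy | x <ᵇ z | y <ᵇ z
  ... | false | false | true | true | true | true = is3124 (<ᵇ≡true⇒< xy) (<ᵇ≡false⇒≥ wy) (<ᵇ≡true⇒< wz)

  Contains : (List ℕ → Set) → List ℕ → Set
  Contains Is σ = ∃ λ u → u ⊆ σ × Is u

  Avoids : List ℕ → Set
  Avoids σ = ¬ Contains Is231 σ × ¬ Contains Is3124 σ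

  contains⇔Contains : ∀ {Is : List ℕ → Set} τ → (∀ {u} → Is u → T (sameOrder τ u)) → (∀ u → T (sameOrder τ u) → Is u) →
                      ∀ σ → T (contains σ τ) ⇔ Contains Is σ
  contains⇔Contains τ is⇒ ⇒is σ = mk⇔ to from
    where
    to : T (contains σ τ) → Contains _ σ
    to t with find (any⁻ (sameOrder τ) (subseqs σ) t)
    ... | u , u∈ , tu = u , ∈-subseqs⁻ σ u∈ , ⇒is u tu
    from : Contains _ σ → T (contains σ τ)
    from (u , τu , is) = any⁺ (sameOrder τ) (lose (∈-subseqs⁺ τu) (is⇒ is))

  avoids231-3124⇔Avoids : ∀ σ → T (avoids231-3124 σ) ⇔ Avoids σ
  avoids231-3124⇔Avoids σ = mk⇔
    (λ t → let a₁ , a₂ = Equivalence.to T-∧ t in not⇒¬ has231 a₁ , not⇒¬ has3124 a₂)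
    (λ (a₁ , a₂) → Equivalence.from T-∧ (¬⇒not has231 a₁ , ¬⇒not has3124 a₂))
    where
    has231 = contains⇔Contains (2 ∷ 3 ∷ 1 ∷ []) Is231⇒sameOrder sameOrder⇒Is231 σ
    has3124 = contains⇔Contains (3 ∷ 1 ∷ 2 ∷ 4 ∷ []) Is3124⇒sameOrder sameOrder⇒Is3124 σ
    not⇒¬ : ∀ {b P} → T b ⇔ P → T (not b) → ¬ P
    not⇒¬ {true} _ ()
    not⇒¬ {false} b⇔P _ p = Equivalence.from b⇔P p
    ¬⇒not : ∀ {b P} → T b ⇔ P → ¬ P → T (not b)
    ¬⇒not {true} b⇔P ¬p = ¬p (Equivalence.to b⇔P tt)
    ¬⇒not {false} _ _ = tt

  Avoids-⊆ : ∀ {σ σ′} → σ ⊆ σ′ → Avoids σ′ → Avoids σ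
  Avoids-⊆ τ (a₁ , a₂) = (λ (u , υ , is) → a₁ (u , ⊆-trans υ τ , is)) , (λ (u , υ , is) → a₂ (u , ⊆-trans υ τ , is))

  Is231-map⁺ : ∀ d {u} → Is231 u → Is231 (map (_+ d) u)
  Is231-map⁺ d (is231 c≤a a<b) = is231 (+-monoˡ-≤ d c≤a) (+-monoˡ-< d a<b)

  Is231-map⁻ : ∀ d {u} → Is231 (map (_+ d) u) → Is231 u
  Is231-map⁻ d {[]} ()
  Is231-map⁻ d {_ ∷ []} ()
  Is231-map⁻ d {_ ∷ _ ∷ []} ()
  Is231-map⁻ d {a ∷ b ∷ c ∷ []} (is231 c≤a a<b) = is231 (+-cancelʳ-≤ d c a c≤a) (+-cancelʳ-< d a b a<b)
  Is231-map⁻ d {_ ∷ _ ∷ _ ∷ _ ∷ _} ()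

  Is3124-map⁺ : ∀ d {u} → Is3124 u → Is3124 (map (_+ d) u)
  Is3124-map⁺ d (is3124 x<y y≤w w<z) = is3124 (+-monoˡ-< d x<y) (+-monoˡ-≤ d y≤w) (+-monoˡ-< d w<z)

  Is3124-map⁻ : ∀ d {u} → Is3124 (map (_+ d) u) → Is3124 u
  Is3124-map⁻ d {[]} ()
  Is3124-map⁻ d {_ ∷ []} ()
  Is3124-map⁻ d {_ ∷ _ ∷ []} ()
  Is3124-map⁻ d {_ ∷ _ ∷ _ ∷ []} ()
  Is3124-map⁻ d {w ∷ x ∷ y ∷ z ∷ []} (is3124 x<y y≤w w<z) =
    is3124 (+-cancelʳ-< d x y x<y) (+-cancelʳ-≤ d y w y≤w) (+-cancelʳ-< d w z w<z)
  Is3124-map⁻ d {_ ∷ _ ∷ _ ∷ _ ∷ _ ∷ _} ()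

  Avoids-map⁺ : ∀ d {τ} → Avoids τ → Avoids (map (_+ d) τ)
  Avoids-map⁺ d {τ} (a₁ , a₂) = unshift (Is231-map⁻ d) a₁ , unshift (Is3124-map⁻ d) a₂
    where
    unshift : ∀ {Is : List ℕ → Set} → (∀ {u} → Is (map (_+ d) u) → Is u) → ¬ Contains Is τ → ¬ Contains Is (map (_+ d) τ)
    unshift is⁻ ¬c (u , υ , is) with ⊆-map⁻ (_+ d) τ υ
    ... | u′ , refl , υ′ = ¬c (u′ , υ′ , is⁻ is)

  Avoids-map⁻ : ∀ d {τ} → Avoids (map (_+ d) τ) → Avoids τ
  Avoids-map⁻ d (a₁ , a₂) =
    (λ (u , υ , is) → a₁ (map (_+ d) u , map⁺ (_+ d) υ , Is231-map⁺ d is)) ,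
    (λ (u , υ , is) → a₂ (map (_+ d) u , map⁺ (_+ d) υ , Is3124-map⁺ d is))

  -- Decreasing runs and blocks of values

  Decreasing : List ℕ → Set
  Decreasing = AllPairs _>_

  Decreasing⇒Unique : ∀ {xs} → Decreasing xs → Unique xs
  Decreasing⇒Unique = AllPairs.map >⇒≢

  desc : ℕ → List ℕ
  desc zero    = []
  desc (suc c) = suc c ∷ desc c

  length-desc : ∀ c → length (desc c) ≡ c
  length-desc zero    = refl
  length-desc (suc c) = cong suc (length-desc c)

  desc-InRange : ∀ c → All (InRange c) (desc c)
  desc-InRange zero    = []
  desc-InRange (suc c) = (s≤s z≤n , ≤-refl) ∷ All.map (λ (1≤v , v≤c) → 1≤v , m≤n⇒m≤1+n v≤c) (desc-InRange c)

  desc-Decreasing : ∀ c → Decreasing (desc c)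
  desc-Decreasing zero    = []
  desc-Decreasing (suc c) = All.map (λ (_ , v≤c) → s≤s v≤c) (desc-InRange c) ∷ desc-Decreasing c

  desc-IsPerm : ∀ c → IsPerm c (desc c)
  desc-IsPerm c = isPerm (length-desc c) (desc-InRange c) (Decreasing⇒Unique (desc-Decreasing c))

  desc-∷ʳ : ∀ c → desc (suc c) ≡ map suc (desc c) ++ [ 1 ]
  desc-∷ʳ zero    = refl
  desc-∷ʳ (suc c) = cong (suc (suc c) ∷_) (desc-∷ʳ c)

  length-≤-of-Unique-InInterval : ∀ a c {xs} → Unique xs → All (λ v → a < v × v ≤ a + c) xs → length xs ≤ c
  length-≤-of-Unique-InInterval a c u xs∈ = begin
    _                ≤⟨ length-≤-of-Unique-⊆ u (λ x∈ → ∈-interval (All.lookup xs∈ x∈)) ⟩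
    length interval  ≡⟨ length-map _ (upTo c) ⟩
    length (upTo c)  ≡⟨ length-upTo c ⟩
    c                ∎
    where
    open ≤-Reasoning
    interval = map (λ i → suc (a + i)) (upTo c)
    ∈-interval : ∀ {v} → a < v × v ≤ a + c → v ∈ interval
    ∈-interval {suc v} (s≤s a≤v , v<a+c) =
      subst (_∈ interval) (cong suc (m+[n∸m]≡n a≤v))
        (∈-map⁺ _ (∈-upTo⁺ (+-cancelˡ-< a _ _ (subst (_< a + c) (sym (m+[n∸m]≡n a≤v)) v<a+c))))

  Decreasing-IsPerm⇒desc : ∀ c {xs} → Decreasing xs → IsPerm c xs → xs ≡ desc c
  Decreasing-IsPerm⇒desc zero {[]} _ _ = refl
  Decreasing-IsPerm⇒desc (suc c) {x ∷ xs} (x>xs ∷ dec) (isPerm len ((1≤x , x≤1+c) ∷ rng) (_ ∷ u))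
    with m≤n⇒m<n∨m≡n x≤1+c
  ... | inj₁ (s≤s x≤c) = contradiction (length-≤-of-Unique-InInterval 0 c (Decreasing⇒Unique (x>xs ∷ dec)) below)
      (λ l≤c → <-irrefl refl (subst (_≤ c) len l≤c))
    where
    below : All (λ v → 0 < v × v ≤ c) (x ∷ xs)
    below = (1≤x , x≤c) ∷ All.zipWith (λ (x>v , 1≤v , _) → 1≤v , ≤-trans (<⇒≤ x>v) x≤c) (x>xs , rng)
  ... | inj₂ refl = cong (suc c ∷_) (Decreasing-IsPerm⇒desc c dec (isPerm (suc-injective len) rng′ u))
    where
    rng′ : All (InRange c) xs
    rng′ = All.zipWith (λ (v<1+c , 1≤v , _) → 1≤v , s≤s⁻¹ v<1+c) (x>xs , rng)

  infix 4 _≪_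
  _≪_ : List ℕ → List ℕ → Set
  xs ≪ ys = ∀ {x y} → x ∈ xs → y ∈ ys → x < y

  Unique-++⇒≢ : ∀ xs {ys : List ℕ} → Unique (xs ++ ys) → ∀ {x y} → x ∈ xs → y ∈ ys → x ≢ y
  Unique-++⇒≢ (a ∷ xs) (a∉ ∷ _) (here refl) y∈ = All.lookup a∉ (∈-++⁺ʳ xs y∈)
  Unique-++⇒≢ (a ∷ xs) (_ ∷ u) (there x∈) y∈ = Unique-++⇒≢ xs u x∈ y∈

  IsPerm-++-comm : ∀ {n} xs {ys} → IsPerm n (xs ++ ys) → IsPerm n (ys ++ xs)
  IsPerm-++-comm {n} xs {ys} (isPerm len rng u) = isPerm len′ rng′ u′
    where
    len′ = begin
      length (ys ++ xs)       ≡⟨ length-++ ys ⟩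
      length ys + length xs   ≡⟨ +-comm (length ys) _ ⟩
      length xs + length ys   ≡⟨ length-++ xs ⟨
      length (xs ++ ys)       ≡⟨ len ⟩
      n                       ∎
      where open ≡-Reasoning
    rng′ = All.++⁺ (All.++⁻ʳ xs rng) (All.++⁻ˡ xs rng)
    u′ = Unique.++⁺ (AllPairs-⊆ (++⁺ˡ xs ⊆-refl) u) (AllPairs-⊆ (++⁺ʳ ys ⊆-refl) u)
           (λ (y∈ , x∈) → Unique-++⇒≢ xs u x∈ y∈ refl)

  separated-bounds : ∀ n xs {ys} → IsPerm n (xs ++ ys) → xs ≪ ys → All (_≤ length xs) xs × All (length xs <_) ys
  separated-bounds n xs {ys} (isPerm len rng u) xs≪ys = All.tabulate lower , All.tabulate upper
    where
    rng-xs = All.++⁻ˡ xs rng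
    rng-ys = All.++⁻ʳ xs rng
    u-xs = AllPairs-⊆ (++⁺ʳ ys ⊆-refl) u
    u-ys = AllPairs-⊆ (++⁺ˡ xs ⊆-refl) u
    lower : ∀ {x} → x ∈ xs → x ≤ length xs
    lower {x} x∈ with x ≤? length xs
    ... | yes x≤l = x≤l
    ... | no x≰l = contradiction n<n (<-irrefl refl)
      where
      open ≤-Reasoning
      x≤n = proj₂ (All.lookup rng-xs x∈)
      ys-above : length ys ≤ n ∸ x
      ys-above = length-≤-of-Unique-InInterval x (n ∸ x) u-ys
        (All.tabulate λ y∈ → xs≪ys x∈ y∈ , subst (_ ≤_) (sym (m+[n∸m]≡n x≤n)) (proj₂ (All.lookup rng-ys y∈)))
      n<n : n < n
      n<n = begin-strict
        n                       ≡⟨ trans (sym len) (length-++ xs) ⟩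
        length xs + length ys   ≤⟨ +-monoʳ-≤ (length xs) ys-above ⟩
        length xs + (n ∸ x)     <⟨ +-monoˡ-< (n ∸ x) (≰⇒> x≰l) ⟩
        x + (n ∸ x)             ≡⟨ m+[n∸m]≡n x≤n ⟩
        n                       ∎
    upper : ∀ {y} → y ∈ ys → length xs < y
    upper {y} y∈ with length xs <? y
    ... | yes l<y = l<y
    ... | no l≮y with All.lookup rng-ys y∈
    ...   | s≤s {n = y′} z≤n , _ = contradiction (≤-<-trans xs-below (≮⇒≥ l≮y)) (<-irrefl refl)
      where
      xs-below : length xs ≤ y′
      xs-below = length-≤-of-Unique-InInterval 0 y′ u-xs
        (All.tabulate λ x∈ → proj₁ (All.lookup rng-xs x∈) , s≤s⁻¹ (xs≪ys x∈ y∈))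

  IsPerm-++-separated : ∀ n xs {ys} → IsPerm n (xs ++ ys) → xs ≪ ys →
    IsPerm (length xs) xs × IsPerm (n ∸ length xs) (map (_∸ length xs) ys) × All (length xs <_) ys
  IsPerm-++-separated n xs {ys} p@(isPerm len rng u) xs≪ys =
    isPerm refl (All.zipWith (λ ((1≤x , _) , x≤l) → 1≤x , x≤l) (All.++⁻ˡ xs rng , xs≤)) (AllPairs-⊆ (++⁺ʳ ys ⊆-refl) u) ,
    isPerm len-ys (All.map⁺ (All.zipWith shifted (ys> , All.++⁻ʳ xs rng)))
      (Unique-map-retract (_∸ l) (_+ l) (λ y∈ → m∸n+n≡m (<⇒≤ (All.lookup ys> y∈))) (AllPairs-⊆ (++⁺ˡ xs ⊆-refl) u)) ,
    ys>
    where
    l = length xs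
    xs≤ = proj₁ (separated-bounds n xs p xs≪ys)
    ys> = proj₂ (separated-bounds n xs p xs≪ys)
    shifted : ∀ {y} → l < y × InRange n y → InRange (n ∸ l) (y ∸ l)
    shifted (l<y , _ , y≤n) = m<n⇒0<n∸m l<y , ∸-monoˡ-≤ l y≤n
    len-ys : length (map (_∸ l) ys) ≡ n ∸ l
    len-ys = begin
      length (map (_∸ l) ys)  ≡⟨ length-map _ ys ⟩
      length ys               ≡⟨ m+n∸m≡n l (length ys) ⟨
      l + length ys ∸ l       ≡⟨ cong (_∸ l) (trans (sym (length-++ xs)) len) ⟩
      n ∸ l                   ∎
      where open ≡-Reasoning

  map-+-∸ : ∀ s {ys} → All (s <_) ys → map (_+ s) (map (_∸ s) ys) ≡ ys
  map-+-∸ s [] = refl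
  map-+-∸ s (s<y ∷ ys>) = cong₂ _∷_ (m∸n+n≡m (<⇒≤ s<y)) (map-+-∸ s ys>)

  Decreasing-map-∸ : ∀ s {ys} → All (s <_) ys → Decreasing ys → Decreasing (map (_∸ s) ys)
  Decreasing-map-∸ s [] [] = []
  Decreasing-map-∸ s (s<y ∷ ys>) (y>ys ∷ dec) =
    All.map⁺ (All.zipWith (λ (y>z , s<z) → ∸-monoˡ-< y>z (<⇒≤ s<z)) (y>ys , ys>)) ∷ Decreasing-map-∸ s ys> dec

  IsPerm-length : ∀ {c xs} → IsPerm c xs → IsPerm (length xs) xs
  IsPerm-length p = subst (λ c → IsPerm c _) (sym (IsPerm.length≡ p)) p

  IsPerm-++-shift : ∀ {a b xs ys} → IsPerm a xs → IsPerm b ys → IsPerm (a + b) (xs ++ map (_+ a) ys)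
  IsPerm-++-shift {a} {b} {xs} {ys} (isPerm lx rx ux) (isPerm ly ry uy) = isPerm len rng uniq
    where
    len = trans (length-++ xs) (cong₂ _+_ lx (trans (length-map _ ys) ly))
    ys-shifted : All (λ v → a < v × v ≤ a + b) (map (_+ a) ys)
    ys-shifted = All.map⁺ (All.map (λ (1≤y , y≤b) → +-monoˡ-≤ a 1≤y ,
                                                      ≤-trans (+-monoˡ-≤ a y≤b) (≤-reflexive (+-comm b a))) ry)
    rng = All.++⁺ (All.map (λ (1≤x , x≤a) → 1≤x , ≤-trans x≤a (m≤m+n a b)) rx)
                  (All.map (λ (a<v , v≤a+b) → ≤-trans (s≤s z≤n) a<v , v≤a+b) ys-shifted)
    uniq = Unique.++⁺ ux (Unique.map⁺ (λ {x} {y} → +-cancelʳ-≡ a x y) uy)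
      (λ (v∈xs , v∈ys) → <-irrefl refl (≤-<-trans (proj₂ (All.lookup rx v∈xs)) (proj₁ (All.lookup ys-shifted v∈ys))))

  Avoids-Decreasing-++ : ∀ m M {P B} → Decreasing P → All (λ p → M < p ⊎ p < m) P → All (λ b → m ≤ b × b ≤ M) B →
                         Avoids B → Avoids (P ++ B)
  Avoids-Decreasing-++ m M {P} {B} decP P-outside B-inside (¬231 , ¬3124) = no231 , no3124
    where
    inB : ∀ {u v} → u ⊆ B → v ∈ u → m ≤ v × v ≤ M
    inB υ v∈ = All.lookup B-inside (Sublist.lookup υ v∈)
    outP : ∀ {u v} → u ⊆ P → v ∈ u → M < v ⊎ v < m
    outP υ v∈ = All.lookup P-outside (Sublist.lookup υ v∈)
    falls : ∀ {a b x₁ x₂ : ℕ} {r s t} → (List ℕ ∋ a ∷ b ∷ s) ≡ x₁ ∷ x₂ ∷ t → x₁ ∷ x₂ ∷ r ⊆ P → b < a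
    falls refl υ = All.lookup (AllPairs.head (AllPairs-⊆ υ decP)) (here refl)
    no231 : ¬ Contains Is231 (P ++ B)
    no231 (u , υ , is) with ⊆-++-split P υ | is
    ... | [] , _ , refl , _ , υB | _ = ¬231 (u , υB , is)
    ... | _ ∷ [] , _ , refl , υP , υB | is231 c≤a a<b with outP υP (here refl)
    ...   | inj₁ M<a = <-asym a<b (≤-<-trans (proj₂ (inB υB (here refl))) M<a)
    ...   | inj₂ a<m = <⇒≱ a<m (≤-trans (proj₁ (inB υB (there (here refl)))) c≤a)
    no231 (u , υ , is) | _ ∷ _ ∷ _ , _ , e , υP , _ | is231 _ a<b = <-asym a<b (falls e υP)
    no3124 : ¬ Contains Is3124 (P ++ B)
    no3124 (u , υ , is) with ⊆-++-split P υ | is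
    ... | [] , _ , refl , _ , υB | _ = ¬3124 (u , υB , is)
    ... | _ ∷ [] , _ , refl , υP , υB | is3124 x<y y≤w w<z with outP υP (here refl)
    ...   | inj₁ M<w = <-asym w<z (≤-<-trans (proj₂ (inB υB (there (there (here refl))))) M<w)
    ...   | inj₂ w<m = <⇒≱ w<m (≤-trans (proj₁ (inB υB (there (here refl)))) y≤w)
    no3124 (u , υ , is) | _ ∷ _ ∷ [] , _ , refl , υP , υB | is3124 x<y y≤w w<z
      with outP υP (there (here refl)) | outP υP (here refl)
    ... | inj₁ M<x | _ = <-asym x<y (≤-<-trans (proj₂ (inB υB (here refl))) M<x)
    ... | inj₂ _ | inj₁ M<w = <-asym w<z (≤-<-trans (proj₂ (inB υB (there (here refl)))) M<w)
    ... | inj₂ _ | inj₂ w<m = <⇒≱ w<m (≤-trans (proj₁ (inB υB (here refl))) y≤w)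
    no3124 (u , υ , is) | _ ∷ _ ∷ _ ∷ _ , _ , e , υP , _ | is3124 x<y _ _ =
      <-asym x<y (falls (proj₂ (∷-injective e)) (∷ˡ⁻ υP))

  -- n, n−1, …, n−j+1, d, …, 2, 1, τ+d for n = j + d + e; for d ≥ 1 the 1 is at position k = j + d.
  layered : ℕ → ℕ → ℕ → List ℕ → List ℕ
  layered j d e τ = (map (_+ (d + e)) (desc j) ++ desc d) ++ map (_+ d) τ

  layered-IsPerm : ∀ j d e {τ} → IsPerm e τ → IsPerm (j + (d + e)) (layered j d e τ)
  layered-IsPerm j d e {τ} pτ = subst₂ IsPerm (+-comm (d + e) j) (sym (++-assoc top (desc d) _))
    (IsPerm-++-comm (desc d ++ map (_+ d) τ) (IsPerm-++-shift (IsPerm-++-shift (desc-IsPerm d) pτ) (desc-IsPerm j)))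
    where top = map (_+ (d + e)) (desc j)

  layered-Avoids : ∀ j d e {τ} → All (InRange e) τ → Avoids τ → Avoids (layered j d e τ)
  layered-Avoids j d e {τ} rτ aτ =
    Avoids-Decreasing-++ (suc d) (d + e) decreasing (All.++⁺ (All.map inj₁ top-above) (All.map (inj₂ ∘ s≤s ∘ proj₂) (desc-InRange d)))
      (All.map⁺ (All.map (λ (1≤v , v≤e) → +-monoˡ-≤ d 1≤v , ≤-trans (+-monoˡ-≤ d v≤e) (≤-reflexive (+-comm e d))) rτ))
      (Avoids-map⁺ d aτ)
    where
    top = map (_+ (d + e)) (desc j)
    top-above : All (d + e <_) top
    top-above = All.map⁺ (All.map (λ (1≤v , _) → +-monoˡ-≤ (d + e) 1≤v) (desc-InRange j))
    decreasing : Decreasing (top ++ desc d)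
    decreasing = AllPairs.++⁺ (AllPairs.map⁺ (AllPairs.map (+-monoˡ-< (d + e)) (desc-Decreasing j))) (desc-Decreasing d)
      (All.map (λ t>d+e → All.map (λ (_ , v≤d) → ≤-<-trans (≤-trans v≤d (m≤m+n d e)) t>d+e) (desc-InRange d)) top-above)

  at-++ : ∀ xs {y} ys → at (xs ++ y ∷ ys) (suc (length xs)) ≡ y
  at-++ []       ys = refl
  at-++ (x ∷ xs) ys = at-++ xs ys

  at-layered : ∀ j d e τ → at (layered j (suc d) e τ) (j + suc d) ≡ 1
  at-layered j d e τ = begin
    at (layered j (suc d) e τ) (j + suc d)      ≡⟨ cong₂ at reshape (+-suc j d) ⟩
    at (front ++ 1 ∷ rest) (suc (j + d))        ≡⟨ cong (at (front ++ 1 ∷ rest) ∘ suc) length-front ⟨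
    at (front ++ 1 ∷ rest) (suc (length front)) ≡⟨ at-++ front rest ⟩
    1                                           ∎
    where
    open ≡-Reasoning
    top = map (_+ (suc d + e)) (desc j)
    front = top ++ map suc (desc d)
    rest = map (_+ suc d) τ
    reshape : layered j (suc d) e τ ≡ front ++ 1 ∷ rest
    reshape = begin
      (top ++ desc (suc d)) ++ rest                 ≡⟨ cong (λ z → (top ++ z) ++ rest) (desc-∷ʳ d) ⟩
      (top ++ (map suc (desc d) ++ [ 1 ])) ++ rest  ≡⟨ cong (_++ rest) (++-assoc top _ [ 1 ]) ⟨
      (front ++ [ 1 ]) ++ rest                      ≡⟨ ++-assoc front [ 1 ] rest ⟩
      front ++ 1 ∷ rest                             ∎
    length-front : length front ≡ j + d
    length-front = trans (length-++ top)
      (cong₂ _+_ (trans (length-map _ (desc j)) (length-desc j)) (trans (length-map suc (desc d)) (length-desc d)))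

  three-blocks⇒layered : ∀ n H X B → IsPerm n (H ++ (X ++ B)) → Decreasing H → Decreasing X → X ≪ B → X ≪ H → B ≪ H →
    let τ = map (_∸ length X) B in
    IsPerm (length B) τ × H ++ (X ++ B) ≡ layered (length H) (length X) (length B) τ
  three-blocks⇒layered n H X B p decH decX X≪B X≪H B≪H = pτ , σ≡
    where
    open ≡-Reasoning
    Y = X ++ B
    d = length X
    e = length B
    Y≪H : Y ≪ H
    Y≪H y∈ h∈ with ∈-++⁻ X y∈
    ... | inj₁ y∈X = X≪H y∈X h∈
    ... | inj₂ y∈B = B≪H y∈B h∈
    separate-H = IsPerm-++-separated n Y (IsPerm-++-comm H p) Y≪H
    separate-B = IsPerm-++-separated (length Y) X (proj₁ separate-H) X≪B
    H′ = map (_∸ length Y) H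
    H′≡ : H′ ≡ desc (length H′)
    H′≡ = Decreasing-IsPerm⇒desc (length H′) (Decreasing-map-∸ (length Y) (proj₂ (proj₂ separate-H)) decH)
            (IsPerm-length (proj₁ (proj₂ separate-H)))
    H≡ : H ≡ map (_+ (d + e)) (desc (length H))
    H≡ = begin
      H                                          ≡⟨ map-+-∸ (length Y) (proj₂ (proj₂ separate-H)) ⟨
      map (_+ length Y) H′                       ≡⟨ cong₂ (λ s c → map (_+ s) c) (length-++ X) (trans H′≡ (cong desc (length-map _ H))) ⟩
      map (_+ (d + e)) (desc (length H))         ∎
    X≡ : X ≡ desc d
    X≡ = Decreasing-IsPerm⇒desc d decX (proj₁ separate-B)
    B≡ : B ≡ map (_+ d) (map (_∸ d) B)
    B≡ = sym (map-+-∸ d (proj₂ (proj₂ separate-B)))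
    pτ : IsPerm e (map (_∸ d) B)
    pτ = subst (λ c → IsPerm c (map (_∸ d) B)) (length-map (_∸ d) B) (IsPerm-length (proj₁ (proj₂ separate-B)))
    σ≡ = begin
      H ++ (X ++ B)                                               ≡⟨ ++-assoc H X B ⟨
      (H ++ X) ++ B                                               ≡⟨ cong₂ (λ h x → (h ++ x) ++ B) H≡ X≡ ⟩
      (map (_+ (d + e)) (desc (length H)) ++ desc d) ++ B         ≡⟨ cong ((map (_+ (d + e)) (desc (length H)) ++ desc d) ++_) B≡ ⟩
      layered (length H) d e (map (_∸ d) B)                       ∎

  at-split : ∀ σ i {y} → at σ (suc i) ≡ suc y → ∃₂ λ α β → σ ≡ α ++ suc y ∷ β × length α ≡ i
  at-split (a ∷ σ) zero    refl = [] , σ , refl , refl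
  at-split (a ∷ σ) (suc i) e with at-split σ i e
  ... | α , β , refl , refl = a ∷ α , β , refl , refl

  prefix-Decreasing : ∀ α β {m} → ¬ Contains Is231 (α ++ m ∷ β) → All (m <_) α → Unique α → Decreasing α
  prefix-Decreasing [] β _ _ _ = []
  prefix-Decreasing (a ∷ α) β ¬231 (m<a ∷ m<α) (a∉α ∷ uα) =
    All.tabulate (λ {b} b∈ → ≤∧≢⇒< (≮⇒≥ (λ a<b → ¬231 (_ , refl ∷ ++⁺ (Sublist.from∈ b∈) (refl ∷ []⊆-universal β) , is231 (<⇒≤ m<a) a<b)))
                                   (λ b≡a → All.lookup a∉α b∈ (sym b≡a)))
    ∷ prefix-Decreasing α β (λ (u , υ , is) → ¬231 (u , _ ∷ʳ υ , is)) m<α uα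

  -- Otherwise a, 1, b₀, b would be an occurrence of 3124, respectively a, b₀, b one of 231.
  above-or-below : ∀ α b₀ β → 1 < b₀ → Avoids (α ++ 1 ∷ b₀ ∷ β) → Unique (α ++ 1 ∷ b₀ ∷ β) →
                   ∀ {a} → a ∈ α → All (_< a) (b₀ ∷ β) ⊎ All (a <_) (b₀ ∷ β)
  above-or-below α b₀ β 1<b₀ (¬231 , ¬3124) u {a} a∈ with <-cmp a b₀
  ... | tri≈ _ a≡b₀ _ = contradiction a≡b₀ (Unique-++⇒≢ α u a∈ (there (here refl)))
  ... | tri> _ _ b₀<a = inj₁ (b₀<a ∷ All.tabulate λ b∈ →
          ≤∧≢⇒< (≮⇒≥ (λ a<b → ¬3124 (_ , ++⁺ (Sublist.from∈ a∈) (refl ∷ refl ∷ Sublist.from∈ b∈) , is3124 1<b₀ (<⇒≤ b₀<a) a<b)))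
                (λ b≡a → Unique-++⇒≢ α u a∈ (there (there b∈)) (sym b≡a)))
  ... | tri< a<b₀ _ _ = inj₂ (a<b₀ ∷ All.tabulate λ b∈ →
          ≰⇒> (λ b≤a → ¬231 (_ , ++⁺ (Sublist.from∈ a∈) (1 ∷ʳ refl ∷ Sublist.from∈ b∈) , is231 b≤a a<b₀)))

  split-above-below : ∀ {B} α → Decreasing α → All (λ a → All (_< a) B ⊎ All (a <_) B) α →
                      ∃₂ λ H L → α ≡ H ++ L × All (λ h → All (_< h) B) H × All (λ l → All (l <_) B) L
  split-above-below [] _ _ = [] , [] , refl , [] , []
  split-above-below (a ∷ α) (_ ∷ decα) (inj₁ B<a ∷ sides) with split-above-below α decα sides
  ... | H , L , refl , B<H , L<B = a ∷ H , L , refl , B<a ∷ B<H , L<B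
  split-above-below (a ∷ α) (a>α ∷ _) (inj₂ a<B ∷ _) =
    [] , a ∷ α , refl , [] , a<B ∷ All.map (λ a>l → All.map (<-trans a>l) a<B) a>α

  block-arithmetic : ∀ {n k j d e} → k ≡ j + d → n ≡ j + (d + e) → k ∸ j ≡ d × n ∸ k ≡ e
  block-arithmetic {j = j} {d} {e} refl refl = m+n∸m≡n j d , trans (cong (_∸ (j + d)) (sym (+-assoc j d e))) (m+n∸m≡n (j + d) e)

  around-1 : ∀ {n} α {B} → IsPerm n (α ++ 1 ∷ B) → All (1 <_) α × All (1 <_) B
  around-1 α {B} (isPerm _ rng u) = All.tabulate (λ a∈ → above (∈-++⁺ˡ a∈) (λ a≡1 → Unique-++⇒≢ α u a∈ (here refl) a≡1)) ,
                                     All.zipWith (λ (1≢b , b∈) → above b∈ (1≢b ∘ sym))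
                                       (AllPairs.head (AllPairs-⊆ (++⁺ˡ α ⊆-refl) u) , All.tabulate (∈-++⁺ʳ α ∘ there))
    where
    above : ∀ {v} → v ∈ α ++ 1 ∷ B → v ≢ 1 → 1 < v
    above v∈ v≢1 = ≤∧≢⇒< (proj₁ (All.lookup rng v∈)) (v≢1 ∘ sym)

  regroup-around : ∀ H L (x : ℕ) B → (H ++ L) ++ x ∷ B ≡ H ++ ((L ++ [ x ]) ++ B)
  regroup-around H L x B = trans (++-assoc H L (x ∷ B)) (cong (H ++_) (sym (++-assoc L [ x ] B)))

  blocks-around-1 : ∀ {n} H L b₀ β → let B = b₀ ∷ β ; X = L ++ [ 1 ] in
    IsPerm n ((H ++ L) ++ 1 ∷ B) → ¬ Contains Is231 ((H ++ L) ++ 1 ∷ B) →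
    All (λ h → All (_< h) B) H → All (λ l → All (l <_) B) L →
    Decreasing H × Decreasing X × X ≪ B × X ≪ H × B ≪ H
  blocks-around-1 H L b₀ β p ¬231 B<H L<B = AllPairs-⊆ (++⁺ʳ L ⊆-refl) decα , decX , X≪B , X≪H , B≪H
    where
    1<α = proj₁ (around-1 (H ++ L) p)
    1<B = proj₂ (around-1 (H ++ L) p)
    decα = prefix-Decreasing (H ++ L) (b₀ ∷ β) ¬231 1<α (AllPairs-⊆ (++⁺ʳ _ ⊆-refl) (IsPerm.unique p))
    decX = AllPairs.++⁺ (AllPairs-⊆ (++⁺ˡ H ⊆-refl) decα) ([] ∷ []) (All.map (_∷ []) (All.++⁻ʳ H 1<α))
    X≪B : L ++ [ 1 ] ≪ b₀ ∷ β
    X≪B x∈ b∈ with ∈-++⁻ L x∈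
    ... | inj₁ x∈L = All.lookup (All.lookup L<B x∈L) b∈
    ... | inj₂ (here refl) = All.lookup 1<B b∈
    X≪H : L ++ [ 1 ] ≪ H
    X≪H x∈ h∈ with ∈-++⁻ L x∈
    ... | inj₁ x∈L = <-trans (All.head (All.lookup L<B x∈L)) (All.head (All.lookup B<H h∈))
    ... | inj₂ (here refl) = All.lookup 1<α (∈-++⁺ˡ h∈)
    B≪H : b₀ ∷ β ≪ H
    B≪H b∈ h∈ = All.lookup (All.lookup B<H h∈) b∈

  layered-shape : ∀ n i {σ} → suc i < n → IsPerm n σ → Avoids σ → at σ (suc i) ≡ 1 →
    ∃₂ λ j τ → j ≤ i × IsPerm (n ∸ suc i) τ × Avoids τ × σ ≡ layered j (suc i ∸ j) (n ∸ suc i) τ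
  layered-shape n i {σ} k<n (isPerm len _ _) _ at≡1 with at-split σ i at≡1
  ... | α , [] , refl , refl = contradiction k<n (<-irrefl (trans (+-comm 1 _) (trans (sym (length-++ α)) len)))
  layered-shape n _ _ p av _ | α , b₀ ∷ β , refl , refl
    with split-above-below α
           (prefix-Decreasing α _ (proj₁ av) (proj₁ (around-1 α p)) (AllPairs-⊆ (++⁺ʳ _ ⊆-refl) (IsPerm.unique p)))
           (All.tabulate (above-or-below α b₀ β (All.head (proj₂ (around-1 α p))) av (IsPerm.unique p)))
  ... | H , L , refl , B<H , L<B with blocks-around-1 H L b₀ β p (proj₁ av) B<H L<B
  ... | decH , decX , X≪B , X≪H , B≪H
    with three-blocks⇒layered _ H (L ++ [ 1 ]) (b₀ ∷ β) (subst (IsPerm _) (regroup-around H L 1 (b₀ ∷ β)) p) decH decX X≪B X≪H B≪H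
  ... | pτ , σ≡ =
    length H , τ , subst (length H ≤_) (sym (length-++ H)) (m≤m+n (length H) (length L)) , subst (λ c → IsPerm c τ) (sym n∸k≡e) pτ ,
    Avoids-map⁻ (length X) (Avoids-⊆ (++⁺ˡ _ ⊆-refl) (subst Avoids σ′≡ av)) ,
    trans σ′≡ (cong₂ (λ d e → layered (length H) d e τ) (sym k∸j≡d) (sym n∸k≡e))
    where
    open ≡-Reasoning
    B = b₀ ∷ β
    X = L ++ [ 1 ]
    τ = map (_∸ length X) B
    σ′≡ = trans (regroup-around H L 1 B) σ≡
    arithmetic = block-arithmetic
      (begin
        suc (length (H ++ L))            ≡⟨ cong suc (length-++ H) ⟩
        suc (length H + length L)        ≡⟨ +-suc (length H) (length L) ⟨
        length H + suc (length L)        ≡⟨ cong (length H +_) (trans (+-comm 1 (length L)) (sym (length-++ L))) ⟩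
        length H + length X              ∎)
      (begin
        _                                ≡⟨ sym (IsPerm.length≡ p) ⟩
        length ((H ++ L) ++ 1 ∷ B)       ≡⟨ cong length (regroup-around H L 1 B) ⟩
        length (H ++ (X ++ B))           ≡⟨ trans (length-++ H) (cong (length H +_) (length-++ X)) ⟩
        length H + (length X + length B) ∎)
    k∸j≡d = proj₁ arithmetic
    n∸k≡e = proj₂ arithmetic

  -- Inverts `layered`: j counts the entries before position k that exceed the entry right after it.
  -- The value (0, []) when nothing follows position k is junk.
  peel : ℕ → List ℕ → List ℕ → ℕ × List ℕ
  peel k front []      = 0 , []
  peel k front (b ∷ β) = j , map (_∸ (k ∸ j)) (b ∷ β)
    where j = length (filterᵇ (b <ᵇ_) front)

  unlayer : ℕ → List ℕ → ℕ × List ℕ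
  unlayer k σ = peel k (take k σ) (drop k σ)

  take-++ : ∀ (xs : List A) ys → take (length xs) (xs ++ ys) ≡ xs
  take-++ []       ys = refl
  take-++ (x ∷ xs) ys = cong (x ∷_) (take-++ xs ys)

  drop-++ : ∀ (xs : List A) ys → drop (length xs) (xs ++ ys) ≡ ys
  drop-++ []       ys = refl
  drop-++ (x ∷ xs) ys = drop-++ xs ys

  map-∸-+ : ∀ s xs → map (_∸ s) (map (_+ s) xs) ≡ xs
  map-∸-+ s []       = refl
  map-∸-+ s (x ∷ xs) = cong₂ _∷_ (m+n∸n≡m x s) (map-∸-+ s xs)

  unlayer-layered : ∀ j d e t τ → All (InRange e) (t ∷ τ) → unlayer (j + d) (layered j d e (t ∷ τ)) ≡ (j , t ∷ τ)
  unlayer-layered j d e t τ ((1≤t , t≤e) ∷ _) = begin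
    unlayer (j + d) (front ++ rest)                  ≡⟨ cong (λ k → unlayer k (front ++ rest)) (sym length-front) ⟩
    unlayer (length front) (front ++ rest)           ≡⟨ cong₂ (peel (length front)) (take-++ front rest) (drop-++ front rest) ⟩
    (above , map (_∸ (length front ∸ above)) rest)   ≡⟨ cong₂ _,_ above≡j (cong (λ s → map (_∸ s) rest) front∸above≡d) ⟩
    (j , map (_∸ d) rest)                            ≡⟨ cong (j ,_) (map-∸-+ d (t ∷ τ)) ⟩
    (j , t ∷ τ)                                      ∎
    where
    open ≡-Reasoning
    top = map (_+ (d + e)) (desc j)
    front = top ++ desc d
    rest = map (_+ d) (t ∷ τ)
    above = length (filterᵇ ((t + d) <ᵇ_) front)
    length-front : length front ≡ j + d
    length-front = trans (length-++ top) (cong₂ _+_ (trans (length-map _ (desc j)) (length-desc j)) (length-desc d))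
    above≡j : above ≡ j
    above≡j = begin
      length (filterᵇ ((t + d) <ᵇ_) (top ++ desc d))                         ≡⟨ cong length (filter-++ _ top (desc d)) ⟩
      length (filterᵇ ((t + d) <ᵇ_) top ++ filterᵇ ((t + d) <ᵇ_) (desc d))
        ≡⟨ cong₂ (λ xs ys → length (xs ++ ys)) (filter-all _ all-above) (filter-none _ none-above) ⟩
      length (top ++ [])                                                      ≡⟨ cong length (++-identityʳ top) ⟩
      length top                                                              ≡⟨ trans (length-map _ (desc j)) (length-desc j) ⟩
      j                                                                       ∎
      where
      all-above = All.map⁺ (All.map (λ (1≤v , _) → <⇒<ᵇ (≤-<-trans (≤-trans (≤-reflexive (+-comm t d)) (+-monoʳ-≤ d t≤e))
                                                                   (+-monoˡ-≤ (d + e) 1≤v)))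
                                    (desc-InRange j))
      none-above = All.map (λ (_ , v≤d) t+d<v → <⇒≱ (<ᵇ⇒< _ _ t+d<v) (≤-trans v≤d (m≤n+m d t))) (desc-InRange d)
    front∸above≡d : length front ∸ above ≡ d
    front∸above≡d = trans (cong₂ _∸_ length-front above≡j) (m+n∸m≡n j d)

  -- Counting the permutations with 1 in position k

  avoiders : ℕ → List (List ℕ)
  avoiders n = filterᵇ avoids231-3124 (perms n)

  avoidersWith1At : ℕ → ℕ → List (List ℕ)
  avoidersWith1At n k = filterᵇ (λ σ → avoids231-3124 σ ∧ (at σ k ≡ᵇ 1)) (perms n)

  ∈-avoiders⇔ : ∀ n {σ} → σ ∈ avoiders n ⇔ (IsPerm n σ × Avoids σ)
  ∈-avoiders⇔ n {σ} = mk⇔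
    (λ σ∈ → let σ∈perms , t = ∈-filterᵇ⁻ _ σ∈ in ∈-perms⁻ n σ∈perms , Equivalence.to (avoids231-3124⇔Avoids σ) t)
    (λ (p , av) → ∈-filterᵇ⁺ _ (∈-perms⁺ n p) (Equivalence.from (avoids231-3124⇔Avoids σ) av))

  ∈-avoidersWith1At⇔ : ∀ n k {σ} → σ ∈ avoidersWith1At n k ⇔ (IsPerm n σ × Avoids σ × at σ k ≡ 1)
  ∈-avoidersWith1At⇔ n k {σ} = mk⇔
    (λ σ∈ → let σ∈perms , t = ∈-filterᵇ⁻ _ σ∈ ; t₁ , t₂ = Equivalence.to T-∧ t in
            ∈-perms⁻ n σ∈perms , Equivalence.to (avoids231-3124⇔Avoids σ) t₁ , ≡ᵇ⇒≡ _ 1 t₂)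
    (λ (p , av , at≡1) → ∈-filterᵇ⁺ _ (∈-perms⁺ n p)
            (Equivalence.from T-∧ (Equivalence.from (avoids231-3124⇔Avoids σ) av , ≡⇒≡ᵇ _ 1 at≡1)))

  countK1≡k*count : ∀ n k → 1 ≤ k → k < n → countK1 n k ≡ k * count (n ∸ k)
  countK1≡k*count n k@(suc i) _ k<n = sym (begin
    k * count e                                        ≡⟨ cong (_* count e) (length-upTo k) ⟨
    length (upTo k) * length (avoiders e)              ≡⟨ length-cartesianProduct (upTo k) (avoiders e) ⟨
    length (cartesianProduct (upTo k) (avoiders e))    ≡⟨ length-≡-of-bijection unique-pairs (Unique-filterᵇ _ (perms-Unique n))
                                                            build (unlayer k) build∈ unlayer∈ unlayer∘build build∘unlayer ⟩
    countK1 n k                                        ∎)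
    where
    open ≡-Reasoning
    e = n ∸ k
    build : ℕ × List ℕ → List ℕ
    build (j , τ) = layered j (k ∸ j) e τ
    unique-pairs = Unique.cartesianProduct⁺ (Unique.upTo⁺ k) (Unique-filterᵇ _ (perms-Unique e))
    k≡ : ∀ {j} → j < k → j + (k ∸ j) ≡ k
    k≡ j<k = m+[n∸m]≡n (<⇒≤ j<k)
    n≡ : ∀ {j} → j < k → j + ((k ∸ j) + e) ≡ n
    n≡ {j} j<k = trans (sym (+-assoc j _ e)) (trans (cong (_+ e) (k≡ j<k)) (m+[n∸m]≡n (<⇒≤ k<n)))
    unlayer-build : ∀ {j τ} → j < k → IsPerm e τ → unlayer k (build (j , τ)) ≡ (j , τ)
    unlayer-build {j} {[]} _ p = contradiction (IsPerm.length≡ p) (<⇒≢ (m<n⇒0<n∸m k<n))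
    unlayer-build {j} {t ∷ τ} j<k p =
      subst (λ k′ → unlayer k′ (build (j , t ∷ τ)) ≡ (j , t ∷ τ)) (k≡ j<k) (unlayer-layered j (k ∸ j) e t τ (IsPerm.inRange p))
    pair⁻ : ∀ {j τ} → (j , τ) ∈ cartesianProduct (upTo k) (avoiders e) → j < k × IsPerm e τ × Avoids τ
    pair⁻ ∈pairs with ∈-cartesianProduct⁻ (upTo k) (avoiders e) ∈pairs
    ... | j∈ , τ∈ = ∈-upTo⁻ j∈ , Equivalence.to (∈-avoiders⇔ e) τ∈
    build∈ : ∀ {p} → p ∈ cartesianProduct (upTo k) (avoiders e) → build p ∈ avoidersWith1At n k
    build∈ {j , τ} ∈pairs with pair⁻ ∈pairs
    ... | j<k , pτ , aτ = Equivalence.from (∈-avoidersWith1At⇔ n k)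
      ( subst (λ c → IsPerm c (build (j , τ))) (n≡ j<k) (layered-IsPerm j (k ∸ j) e pτ)
      , layered-Avoids j (k ∸ j) e (IsPerm.inRange pτ) aτ
      , subst (λ k′ → at (build (j , τ)) k′ ≡ 1) (k≡ j<k)
          (subst (λ d → at (layered j d e τ) (j + d) ≡ 1) (sym (+-∸-assoc 1 j<k)) (at-layered j (k ∸ suc j) e τ)))
    unlayer∘build : ∀ {p} → p ∈ cartesianProduct (upTo k) (avoiders e) → unlayer k (build p) ≡ p
    unlayer∘build ∈pairs with pair⁻ ∈pairs
    ... | j<k , pτ , _ = unlayer-build j<k pτ
    shape : ∀ {σ} → σ ∈ avoidersWith1At n k → ∃₂ λ j τ → j < k × IsPerm e τ × Avoids τ × σ ≡ build (j , τ)
    shape σ∈ with Equivalence.to (∈-avoidersWith1At⇔ n k) σ∈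
    ... | p , av , at≡1 with layered-shape n i k<n p av at≡1
    ...   | j , τ , j≤i , pτ , aτ , σ≡ = j , τ , s≤s j≤i , pτ , aτ , σ≡
    unlayer∈ : ∀ {σ} → σ ∈ avoidersWith1At n k → unlayer k σ ∈ cartesianProduct (upTo k) (avoiders e)
    unlayer∈ σ∈ with shape σ∈
    ... | j , τ , j<k , pτ , aτ , refl = subst (_∈ _) (sym (unlayer-build j<k pτ))
                                           (∈-cartesianProduct⁺ (∈-upTo⁺ j<k) (Equivalence.from (∈-avoiders⇔ e) (pτ , aτ)))
    build∘unlayer : ∀ {σ} → σ ∈ avoidersWith1At n k → build (unlayer k σ) ≡ σ
    build∘unlayer σ∈ with shape σ∈
    ... | j , τ , j<k , pτ , _ , refl = cong build (unlayer-build j<k pτ)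

  -- The recurrence for |S_n(231,3124)|

  desc-Avoids : ∀ c → Avoids (desc c)
  desc-Avoids c = subst Avoids (++-identityʳ (desc c)) (layered-Avoids 0 c 0 [] ((λ { (_ , [] , ()) }) , (λ { (_ , [] , ()) })))

  desc-at : ∀ m → at (desc (suc m)) (suc m) ≡ 1
  desc-at m = subst (λ σ → at σ (suc m) ≡ 1) (++-identityʳ (desc (suc m))) (at-layered 0 m 0 [])

  desc-shape : ∀ m {σ} → IsPerm (suc m) σ → Avoids σ → at σ (suc m) ≡ 1 → σ ≡ desc (suc m)
  desc-shape m {σ} p av at≡1 with at-split σ m at≡1
  ... | α , b ∷ β , refl , refl =
    contradiction (trans (sym (+-suc (length α) (suc (length β)))) (trans (sym (length-++ α)) (IsPerm.length≡ p))) (m+1+n≢m (suc (length α)))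
  ... | α , [] , refl , refl = Decreasing-IsPerm⇒desc (suc (length α)) (AllPairs.++⁺ decα ([] ∷ []) (All.map (_∷ []) 1<α)) p
    where
    1<α = proj₁ (around-1 α p)
    decα = prefix-Decreasing α [] (proj₁ av) 1<α (AllPairs-⊆ (++⁺ʳ _ ⊆-refl) (IsPerm.unique p))

  countK1-last : ∀ m → countK1 (suc m) (suc m) ≡ 1
  countK1-last m = length-≡-of-bijection (Unique-filterᵇ _ (perms-Unique (suc m))) ([] ∷ [])
    (λ _ → desc (suc m)) (λ σ → σ)
    (λ _ → here refl)
    (λ { (here refl) → Equivalence.from (∈-avoidersWith1At⇔ (suc m) (suc m)) (desc-IsPerm (suc m) , desc-Avoids (suc m) , desc-at m) })
    (λ σ∈ → let p , av , at≡1 = Equivalence.to (∈-avoidersWith1At⇔ (suc m) (suc m)) σ∈ in sym (desc-shape m p av at≡1))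
    (λ { (here refl) → refl })

  ∑ : ℕ → (ℕ → ℕ) → ℕ
  ∑ zero    f = 0
  ∑ (suc m) f = f 0 + ∑ m (f ∘ suc)

  ∑-cong : ∀ m {f g} → (∀ i → i < m → f i ≡ g i) → ∑ m f ≡ ∑ m g
  ∑-cong zero    _   = refl
  ∑-cong (suc m) f≡g = cong₂ _+_ (f≡g 0 (s≤s z≤n)) (∑-cong m (λ i i<m → f≡g (suc i) (s≤s i<m)))

  ∑-zero : ∀ m → ∑ m (λ _ → 0) ≡ 0
  ∑-zero zero    = refl
  ∑-zero (suc m) = ∑-zero m

  ∑-+ : ∀ m f g → ∑ m (λ i → f i + g i) ≡ ∑ m f + ∑ m g
  ∑-+ zero    f g = refl
  ∑-+ (suc m) f g = trans (cong (f 0 + g 0 +_) (∑-+ m (f ∘ suc) (g ∘ suc))) (+-+-comm (f 0) (g 0) _ _)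
    where
    +-+-comm : ∀ a b c d → a + b + (c + d) ≡ a + c + (b + d)
    +-+-comm = solve-∀

  ∑-last : ∀ m f → ∑ (suc m) f ≡ ∑ m f + f m
  ∑-last zero    f = +-comm (f 0) 0
  ∑-last (suc m) f = trans (cong (f 0 +_) (∑-last m (f ∘ suc))) (sym (+-assoc (f 0) _ _))

  indicator : Bool → ℕ
  indicator true  = 1
  indicator false = 0

  length-filterᵇ-partition : ∀ (P : A → Bool) (Q : ℕ → A → Bool) m xs → (∀ {x} → x ∈ xs → ∑ m (λ i → indicator (Q i x)) ≡ 1) →
    length (filterᵇ P xs) ≡ ∑ m (λ i → length (filterᵇ (λ x → P x ∧ Q i x) xs))
  length-filterᵇ-partition P Q m [] _ = sym (∑-zero m)
  length-filterᵇ-partition P Q m (x ∷ xs) once = begin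
    length (filterᵇ P (x ∷ xs))                                         ≡⟨ length-filterᵇ-∷ P ⟩
    indicator (P x) + length (filterᵇ P xs)                             ≡⟨ cong₂ _+_ split-x (length-filterᵇ-partition P Q m xs (once ∘ there)) ⟩
    ∑ m (λ i → indicator (P x ∧ Q i x)) + ∑ m (λ i → length (filterᵇ (PQ i) xs)) ≡⟨ ∑-+ m _ _ ⟨
    ∑ m (λ i → indicator (P x ∧ Q i x) + length (filterᵇ (PQ i) xs))   ≡⟨ ∑-cong m (λ i _ → length-filterᵇ-∷ (PQ i)) ⟨
    ∑ m (λ i → length (filterᵇ (PQ i) (x ∷ xs)))                        ∎
    where
    open ≡-Reasoning
    PQ = λ i x → P x ∧ Q i x
    length-filterᵇ-∷ : ∀ (R : _ → Bool) → length (filterᵇ R (x ∷ xs)) ≡ indicator (R x) + length (filterᵇ R xs)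
    length-filterᵇ-∷ R with R x
    ... | true  = refl
    ... | false = refl
    split-x : indicator (P x) ≡ ∑ m (λ i → indicator (P x ∧ Q i x))
    split-x with P x
    ... | true  = sym (once (here refl))
    ... | false = sym (∑-zero m)

  1∈-IsPerm : ∀ m {σ} → IsPerm (suc m) σ → 1 ∈ σ
  1∈-IsPerm m {σ} (isPerm len rng u) with 1 ∈? σ
  ... | yes 1∈σ = 1∈σ
  ... | no 1∉σ = contradiction (length-≤-of-Unique-InInterval 1 m u above-1) (λ σ≤m → <-irrefl len (s≤s σ≤m))
    where
    above-1 : All (λ v → 1 < v × v ≤ suc m) σ
    above-1 = All.tabulate λ v∈ → ≤∧≢⇒< (proj₁ (All.lookup rng v∈)) (λ 1≡v → 1∉σ (subst (_∈ σ) (sym 1≡v) v∈)) , proj₂ (All.lookup rng v∈)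

  position-of-1-unique : ∀ σ → Unique σ → 1 ∈ σ → ∑ (length σ) (λ i → indicator (at σ (suc i) ≡ᵇ 1)) ≡ 1
  position-of-1-unique (a ∷ σ) (a∉σ ∷ u) 1∈ with a ≟ 1 | 1∈
  ... | yes refl | _ = cong suc (trans (∑-cong (length σ) (λ i _ → not-1 i)) (∑-zero (length σ)))
    where
    not-1 : ∀ i → indicator (at σ (suc i) ≡ᵇ 1) ≡ 0
    not-1 i with at σ (suc i) ≡ᵇ 1 in eq
    ... | false = refl
    ... | true with at-split σ i (≡ᵇ⇒≡ _ 1 (subst T (sym eq) tt))
    ...   | α , _ , refl , _ = contradiction refl (All.lookup a∉σ (∈-++⁺ʳ α (here refl)))
  ... | no a≢1 | here 1≡a = contradiction (sym 1≡a) a≢1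
  ... | no a≢1 | there 1∈σ rewrite Equivalence.to T-not-≡ (≢⇒T-not-≡ᵇ a≢1) = position-of-1-unique σ u 1∈σ

  count≡∑countK1 : ∀ m → count (suc m) ≡ ∑ (suc m) (λ i → countK1 (suc m) (suc i))
  count≡∑countK1 m = length-filterᵇ-partition avoids231-3124 (λ i σ → at σ (suc i) ≡ᵇ 1) (suc m) (perms (suc m)) once
    where
    once : ∀ {σ} → σ ∈ perms (suc m) → ∑ (suc m) (λ i → indicator (at σ (suc i) ≡ᵇ 1)) ≡ 1
    once {σ} σ∈ with ∈-perms⁻ (suc m) σ∈
    ... | p@(isPerm len _ u) = subst (λ l → ∑ l (λ i → indicator (at σ (suc i) ≡ᵇ 1)) ≡ 1) len (position-of-1-unique σ u (1∈-IsPerm m p))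

  weighted : ℕ → ℕ
  weighted m = ∑ m (λ i → suc i * count (m ∸ i))

  partial : ℕ → ℕ
  partial m = ∑ m (λ i → count (m ∸ i))

  count-suc : ∀ m → count (suc m) ≡ 1 + weighted m
  count-suc m = begin
    count (suc m)                               ≡⟨ count≡∑countK1 m ⟩
    ∑ (suc m) (λ i → countK1 (suc m) (suc i))   ≡⟨ ∑-last m _ ⟩
    ∑ m (λ i → countK1 (suc m) (suc i)) + countK1 (suc m) (suc m)
      ≡⟨ cong₂ _+_ (∑-cong m (λ i i<m → countK1≡k*count (suc m) (suc i) (s≤s z≤n) (s≤s i<m))) (countK1-last m) ⟩
    weighted m + 1                              ≡⟨ +-comm (weighted m) 1 ⟩
    1 + weighted m                              ∎
    where open ≡-Reasoning

  weighted-suc : ∀ m → weighted (suc m) ≡ count (suc m) + (partial m + weighted m)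
  weighted-suc m = cong₂ _+_ (+-identityʳ (count (suc m))) (∑-+ m (λ i → count (m ∸ i)) (λ i → suc i * count (m ∸ i)))

  count-recurrence : ∀ m → count (3 + m) + count (1 + m) ≡ 3 * count (2 + m)
  count-recurrence m = combine (count-suc m) (count-suc (1 + m)) (weighted-suc m) (count-suc (2 + m)) (weighted-suc (1 + m))
    where
    combine : ∀ {c₁ c₂ c₃ W P W₁ W₂} → c₁ ≡ 1 + W → c₂ ≡ 1 + W₁ → W₁ ≡ c₁ + (P + W) →
              c₃ ≡ 1 + W₂ → W₂ ≡ c₂ + ((c₁ + P) + W₁) → c₃ + c₁ ≡ 3 * c₂
    combine {W = W} {P} refl refl refl refl refl = identity W P
      where
      identity : ∀ W P → 1 + ((1 + ((1 + W) + (P + W))) + (((1 + W) + P) + ((1 + W) + (P + W)))) + (1 + W)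
                         ≡ 3 * (1 + ((1 + W) + (P + W)))
      identity = solve-∀


module GeneratingFunction where

  open import Defs
  open Permutations using (countK1≡k*count; countK1-last; count-recurrence)
  open import Data.Bool using (true; false; T; _∧_; if_then_else_)
  open import Data.Unit using (tt)
  open import Data.Nat as ℕ using (ℕ; zero; suc; _∸_; _≤_; _<_; z≤n; s≤s; s≤s⁻¹; _≡ᵇ_; _≤ᵇ_)
  import Data.Nat.Properties as ℕ
  open import Data.Integer using (ℤ; +_; _+_; _*_; _-_)
  open import Data.Integer.Properties using (+-identityˡ; +-identityʳ; +-assoc; *-zeroˡ; *-zeroʳ; *-identityˡ; *-identityʳ; *-distribˡ-+; pos-+; pos-*)
  open import Data.Integer.Tactic.RingSolver using (solve-∀)
  open import Data.List using (List; []; _∷_; _++_; map; concatMap; upTo; applyUpTo)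
  open import Data.List.Properties using (map-upTo; map-cong)
  open import Data.Sum using (_⊎_; inj₁; inj₂)
  open import Function using (_∘_)
  open import Relation.Nullary using (¬_; yes; no; contradiction)
  open import Relation.Binary.PropositionalEquality
  open import Relation.Binary.Definitions using (tri<; tri≈; tri>)

  ∑ : ℕ → (ℕ → ℤ) → ℤ
  ∑ zero    h = + 0
  ∑ (suc n) h = h 0 + ∑ n (h ∘ suc)

  sumℤ-++ : ∀ xs ys → sumℤ (xs ++ ys) ≡ sumℤ xs + sumℤ ys
  sumℤ-++ []       ys = sym (+-identityˡ _)
  sumℤ-++ (x ∷ xs) ys = trans (cong (λ z → x + z) (sumℤ-++ xs ys)) (sym (+-assoc x _ _))

  sumℤ-concatMap : ∀ {A : Set} (F : A → List ℤ) xs → sumℤ (concatMap F xs) ≡ sumℤ (map (sumℤ ∘ F) xs)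
  sumℤ-concatMap F []       = refl
  sumℤ-concatMap F (x ∷ xs) = trans (sumℤ-++ (F x) _) (cong (λ z → sumℤ (F x) + z) (sumℤ-concatMap F xs))

  sumℤ-applyUpTo : ∀ n h → sumℤ (applyUpTo h n) ≡ ∑ n h
  sumℤ-applyUpTo zero    h = refl
  sumℤ-applyUpTo (suc n) h = cong (λ z → h 0 + z) (sumℤ-applyUpTo n (h ∘ suc))

  sumℤ-map-upTo : ∀ n h → sumℤ (map h (upTo n)) ≡ ∑ n h
  sumℤ-map-upTo n h = trans (cong sumℤ (map-upTo h n)) (sumℤ-applyUpTo n h)

  *ₛ-coefficient : ∀ f g i j → (f *ₛ g) i j ≡ ∑ (suc i) (λ a → ∑ (suc j) (λ b → f a b * g (i ∸ a) (j ∸ b)))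
  *ₛ-coefficient f g i j = begin
    sumℤ (concatMap row (upTo (suc i)))              ≡⟨ sumℤ-concatMap row (upTo (suc i)) ⟩
    sumℤ (map (sumℤ ∘ row) (upTo (suc i)))           ≡⟨ cong sumℤ (map-cong (λ a → sumℤ-map-upTo (suc j) (term a)) (upTo (suc i))) ⟩
    sumℤ (map (λ a → ∑ (suc j) (term a)) (upTo (suc i))) ≡⟨ sumℤ-map-upTo (suc i) (λ a → ∑ (suc j) (term a)) ⟩
    ∑ (suc i) (λ a → ∑ (suc j) (term a))             ∎
    where
    open ≡-Reasoning
    term = λ a b → f a b * g (i ∸ a) (j ∸ b)
    row = λ a → map (term a) (upTo (suc j))

  ∑-cong : ∀ n {h h′} → (∀ a → a < n → h a ≡ h′ a) → ∑ n h ≡ ∑ n h′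
  ∑-cong zero    _    = refl
  ∑-cong (suc n) h≡h′ = cong₂ _+_ (h≡h′ 0 (s≤s z≤n)) (∑-cong n (λ a a<n → h≡h′ (suc a) (s≤s a<n)))

  ∑-zero : ∀ n h → (∀ a → a < n → h a ≡ + 0) → ∑ n h ≡ + 0
  ∑-zero zero    _ _   = refl
  ∑-zero (suc n) h h≡0 = cong₂ _+_ (h≡0 0 (s≤s z≤n)) (∑-zero n (h ∘ suc) (λ a a<n → h≡0 (suc a) (s≤s a<n)))

  ∑-single : ∀ n h a₀ → a₀ < n → (∀ a → a < n → a ≢ a₀ → h a ≡ + 0) → ∑ n h ≡ h a₀
  ∑-single (suc n) h zero _ others =
    trans (cong (λ z → h 0 + z) (∑-zero n (h ∘ suc) (λ a a<n → others (suc a) (s≤s a<n) (λ ())))) (+-identityʳ (h 0))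
  ∑-single (suc n) h (suc a₀) (s≤s a₀<n) others =
    trans (cong (_+ ∑ n (h ∘ suc)) (others 0 (s≤s z≤n) (λ ()))) (trans (+-identityˡ _)
          (∑-single n (h ∘ suc) a₀ a₀<n (λ a a<n a≢a₀ → others (suc a) (s≤s a<n) (a≢a₀ ∘ ℕ.suc-injective))))

  ∑-+ : ∀ n h k → ∑ n (λ a → h a + k a) ≡ ∑ n h + ∑ n k
  ∑-+ zero    h k = refl
  ∑-+ (suc n) h k = trans (cong (λ z → h 0 + k 0 + z) (∑-+ n (h ∘ suc) (k ∘ suc))) (+-+-comm (h 0) (k 0) _ _)
    where
    +-+-comm : ∀ a b c d → a + b + (c + d) ≡ a + c + (b + d)
    +-+-comm = solve-∀

  ∑-- : ∀ n h k → ∑ n (λ a → h a - k a) ≡ ∑ n h - ∑ n k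
  ∑-- zero    h k = refl
  ∑-- (suc n) h k = trans (cong (λ z → h 0 - k 0 + z) (∑-- n (h ∘ suc) (k ∘ suc))) (-+-comm (h 0) (k 0) _ _)
    where
    -+-comm : ∀ a b c d → a - b + (c - d) ≡ a + c - (b + d)
    -+-comm = solve-∀

  *ₛ-cong : ∀ {f f′ g g′} → f ≈ₛ f′ → g ≈ₛ g′ → f *ₛ g ≈ₛ f′ *ₛ g′
  *ₛ-cong {f} {f′} {g} {g′} f≈ g≈ i j = begin
    (f *ₛ g) i j                               ≡⟨ *ₛ-coefficient f g i j ⟩
    ∑ (suc i) (λ a → ∑ (suc j) (term f g a))   ≡⟨ ∑-cong (suc i) {λ a → ∑ (suc j) (term f g a)} (λ a _ →
                                                    ∑-cong (suc j) {term f g a} (λ b _ → cong₂ _*_ (f≈ a b) (g≈ _ _))) ⟩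
    ∑ (suc i) (λ a → ∑ (suc j) (term f′ g′ a)) ≡⟨ *ₛ-coefficient f′ g′ i j ⟨
    (f′ *ₛ g′) i j                             ∎
    where
    open ≡-Reasoning
    term : Series → Series → ℕ → ℕ → ℤ
    term f g a b = f a b * g (i ∸ a) (j ∸ b)

  *ₛ-distribˡ : ∀ (_⊕_ : ℤ → ℤ → ℤ) → (∀ x y z → x * (y ⊕ z) ≡ (x * y) ⊕ (x * z)) →
                 (∀ n p q → ∑ n (λ a → p a ⊕ q a) ≡ ∑ n p ⊕ ∑ n q) →
                 ∀ f g h → f *ₛ (λ i j → g i j ⊕ h i j) ≈ₛ (λ i j → (f *ₛ g) i j ⊕ (f *ₛ h) i j)
  *ₛ-distribˡ _⊕_ distrib ∑-⊕ f g h i j = begin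
    (f *ₛ (λ i j → g i j ⊕ h i j)) i j                      ≡⟨ *ₛ-coefficient f (λ i j → g i j ⊕ h i j) i j ⟩
    ∑ (suc i) (λ a → ∑ (suc j) (λ b → f a b * (G a b ⊕ H a b)))
      ≡⟨ ∑-cong (suc i) (λ a _ → trans (∑-cong (suc j) (λ b _ → distrib (f a b) (G a b) (H a b))) (∑-⊕ (suc j) (FG a) (FH a))) ⟩
    ∑ (suc i) (λ a → ∑ (suc j) (FG a) ⊕ ∑ (suc j) (FH a))   ≡⟨ ∑-⊕ (suc i) (λ a → ∑ (suc j) (FG a)) (λ a → ∑ (suc j) (FH a)) ⟩
    ∑ (suc i) (λ a → ∑ (suc j) (FG a)) ⊕ ∑ (suc i) (λ a → ∑ (suc j) (FH a)) ≡⟨ cong₂ _⊕_ (*ₛ-coefficient f g i j) (*ₛ-coefficient f h i j) ⟨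
    (f *ₛ g) i j ⊕ (f *ₛ h) i j                             ∎
    where
    open ≡-Reasoning
    G = λ a b → g (i ∸ a) (j ∸ b)
    H = λ a b → h (i ∸ a) (j ∸ b)
    FG = λ a b → f a b * G a b
    FH = λ a b → f a b * H a b

  *ₛ-distribˡ-+ : ∀ f g h → f *ₛ (g +ₛ h) ≈ₛ f *ₛ g +ₛ f *ₛ h
  *ₛ-distribˡ-+ = *ₛ-distribˡ _+_ *-distribˡ-+ ∑-+

  *ₛ-distribˡ-- : ∀ f g h → f *ₛ (g -ₛ h) ≈ₛ f *ₛ g -ₛ f *ₛ h
  *ₛ-distribˡ-- = *ₛ-distribˡ _-_ *-distribˡ-- ∑--
    where
    *-distribˡ-- : ∀ x y z → x * (y - z) ≡ x * y - x * z
    *-distribˡ-- = solve-∀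

  shift : ℕ → ℕ → Series → Series
  shift a b f i j = if (a ≤ᵇ i) ∧ (b ≤ᵇ j) then f (i ∸ a) (j ∸ b) else + 0

  shift-in : ∀ a b f i j → a ≤ i → b ≤ j → shift a b f i j ≡ f (i ∸ a) (j ∸ b)
  shift-in a b f i j a≤i b≤j with a ≤ᵇ i | ℕ.≤⇒≤ᵇ a≤i | b ≤ᵇ j | ℕ.≤⇒≤ᵇ b≤j
  ... | true | _ | true | _ = refl

  shift-out : ∀ a b f i j → ¬ a ≤ i ⊎ ¬ b ≤ j → shift a b f i j ≡ + 0
  shift-out a b f i j out with a ≤ᵇ i in eqa | b ≤ᵇ j in eqb
  ... | false | _ = refl
  ... | true | false = refl
  ... | true | true with out
  ...   | inj₁ a≰i = contradiction (ℕ.≤ᵇ⇒≤ a i (subst T (sym eqa) tt)) a≰i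
  ...   | inj₂ b≰j = contradiction (ℕ.≤ᵇ⇒≤ b j (subst T (sym eqb) tt)) b≰j

  mono-hit : ∀ c a b → mono c a b a b ≡ c
  mono-hit c a b with a ≡ᵇ a | ℕ.≡⇒≡ᵇ a a refl | b ≡ᵇ b | ℕ.≡⇒≡ᵇ b b refl
  ... | true | _ | true | _ = refl

  mono-miss : ∀ c a b i j → i ≢ a ⊎ j ≢ b → mono c a b i j ≡ + 0
  mono-miss c a b i j miss with i ≡ᵇ a in eqa | j ≡ᵇ b in eqb
  ... | false | _ = refl
  ... | true | false = refl
  ... | true | true with miss
  ...   | inj₁ i≢a = contradiction (ℕ.≡ᵇ⇒≡ i a (subst T (sym eqa) tt)) i≢a
  ...   | inj₂ j≢b = contradiction (ℕ.≡ᵇ⇒≡ j b (subst T (sym eqb) tt)) j≢b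

  private
    ∸-back : ∀ {m n k} → k ≤ m → m ∸ k ≡ n → k ≡ m ∸ n
    ∸-back {m} k≤m m∸k≡n = trans (sym (ℕ.m∸[m∸n]≡n k≤m)) (cong (m ∸_) m∸k≡n)

    *ₛ-mono-outside : ∀ f c a b i j → ¬ a ≤ i ⊎ ¬ b ≤ j → (f *ₛ mono c a b) i j ≡ + 0
    *ₛ-mono-outside f c a b i j out = trans (*ₛ-coefficient f (mono c a b) i j)
      (∑-zero (suc i) (λ a′ → ∑ (suc j) (term a′)) (λ a′ _ → ∑-zero (suc j) (term a′) (λ b′ _ →
        trans (cong (f a′ b′ *_) (mono-miss c a b (i ∸ a′) (j ∸ b′)
                (Data.Sum.map (λ a≰i i∸a′≡a → a≰i (subst (_≤ i) i∸a′≡a (ℕ.m∸n≤m i a′)))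
                                                               (λ b≰j j∸b′≡b → b≰j (subst (_≤ j) j∸b′≡b (ℕ.m∸n≤m j b′))) out)))
              (*-zeroʳ (f a′ b′)))))
      where
      term = λ a′ b′ → f a′ b′ * mono c a b (i ∸ a′) (j ∸ b′)

  *ₛ-mono : ∀ f c a b → f *ₛ mono c a b ≈ₛ shift a b (λ i j → f i j * c)
  *ₛ-mono f c a b i j with a ℕ.≤? i | b ℕ.≤? j
  ... | no a≰i | _       = trans (*ₛ-mono-outside f c a b i j (inj₁ a≰i)) (sym (shift-out a b (λ i j → f i j * c) i j (inj₁ a≰i)))
  ... | yes _  | no b≰j  = trans (*ₛ-mono-outside f c a b i j (inj₂ b≰j)) (sym (shift-out a b (λ i j → f i j * c) i j (inj₂ b≰j)))
  ... | yes a≤i | yes b≤j = trans inside (sym (shift-in a b (λ i j → f i j * c) i j a≤i b≤j))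
    where
    open ≡-Reasoning
    term = λ a′ b′ → f a′ b′ * mono c a b (i ∸ a′) (j ∸ b′)
    inside = begin
      (f *ₛ mono c a b) i j                                                  ≡⟨ *ₛ-coefficient f (mono c a b) i j ⟩
      ∑ (suc i) (λ a′ → ∑ (suc j) (λ b′ → f a′ b′ * mono c a b (i ∸ a′) (j ∸ b′)))
        ≡⟨ ∑-single (suc i) (λ a′ → ∑ (suc j) (term a′)) (i ∸ a) (s≤s (ℕ.m∸n≤m i a)) (λ a′ a′≤i a′≢ →
             ∑-zero (suc j) (term a′) (λ b′ _ → trans (cong (f a′ b′ *_) (mono-miss c a b (i ∸ a′) (j ∸ b′) (inj₁ (a′≢ ∘ ∸-back (s≤s⁻¹ a′≤i)))))
                                                    (*-zeroʳ (f a′ b′)))) ⟩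
      ∑ (suc j) (λ b′ → f (i ∸ a) b′ * mono c a b (i ∸ (i ∸ a)) (j ∸ b′))
        ≡⟨ ∑-single (suc j) (term (i ∸ a)) (j ∸ b) (s≤s (ℕ.m∸n≤m j b)) (λ b′ b′≤j b′≢ →
             trans (cong (f (i ∸ a) b′ *_) (mono-miss c a b (i ∸ (i ∸ a)) (j ∸ b′) (inj₂ (b′≢ ∘ ∸-back (s≤s⁻¹ b′≤j)))))
                   (*-zeroʳ (f (i ∸ a) b′))) ⟩
      f (i ∸ a) (j ∸ b) * mono c a b (i ∸ (i ∸ a)) (j ∸ (j ∸ b))
        ≡⟨ cong (f (i ∸ a) (j ∸ b) *_) (trans (cong₂ (mono c a b) (ℕ.m∸[m∸n]≡n a≤i) (ℕ.m∸[m∸n]≡n b≤j)) (mono-hit c a b)) ⟩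
      f (i ∸ a) (j ∸ b) * c                                                  ∎

  private
    mono-*ₛ-outside : ∀ c a b g i j → ¬ a ≤ i ⊎ ¬ b ≤ j → (mono c a b *ₛ g) i j ≡ + 0
    mono-*ₛ-outside c a b g i j out = trans (*ₛ-coefficient (mono c a b) g i j)
      (∑-zero (suc i) (λ a′ → ∑ (suc j) (term a′)) (λ a′ a′≤i → ∑-zero (suc j) (term a′) (λ b′ b′≤j →
        trans (cong (_* g (i ∸ a′) (j ∸ b′)) (mono-miss c a b a′ b′
                (Data.Sum.map (λ a≰i a′≡a → a≰i (subst (_≤ i) a′≡a (s≤s⁻¹ a′≤i))) (λ b≰j b′≡b → b≰j (subst (_≤ j) b′≡b (s≤s⁻¹ b′≤j))) out)))
              (*-zeroˡ (g (i ∸ a′) (j ∸ b′))))))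
      where
      term = λ a′ b′ → mono c a b a′ b′ * g (i ∸ a′) (j ∸ b′)

  mono-*ₛ : ∀ c a b g → mono c a b *ₛ g ≈ₛ shift a b (λ i j → c * g i j)
  mono-*ₛ c a b g i j with a ℕ.≤? i | b ℕ.≤? j
  ... | no a≰i | _       = trans (mono-*ₛ-outside c a b g i j (inj₁ a≰i)) (sym (shift-out a b (λ i j → c * g i j) i j (inj₁ a≰i)))
  ... | yes _  | no b≰j  = trans (mono-*ₛ-outside c a b g i j (inj₂ b≰j)) (sym (shift-out a b (λ i j → c * g i j) i j (inj₂ b≰j)))
  ... | yes a≤i | yes b≤j = trans inside (sym (shift-in a b (λ i j → c * g i j) i j a≤i b≤j))
    where
    open ≡-Reasoning
    term = λ a′ b′ → mono c a b a′ b′ * g (i ∸ a′) (j ∸ b′)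
    inside = begin
      (mono c a b *ₛ g) i j                          ≡⟨ *ₛ-coefficient (mono c a b) g i j ⟩
      ∑ (suc i) (λ a′ → ∑ (suc j) (term a′))         ≡⟨ ∑-single (suc i) (λ a′ → ∑ (suc j) (term a′)) a (s≤s a≤i) (λ a′ _ a′≢a →
                                                          ∑-zero (suc j) (term a′) (λ b′ _ → trans (cong (_* g (i ∸ a′) (j ∸ b′))
                                                            (mono-miss c a b a′ b′ (inj₁ a′≢a))) (*-zeroˡ (g (i ∸ a′) (j ∸ b′))))) ⟩
      ∑ (suc j) (term a)                             ≡⟨ ∑-single (suc j) (term a) b (s≤s b≤j) (λ b′ _ b′≢b →
                                                          trans (cong (_* g (i ∸ a) (j ∸ b′)) (mono-miss c a b a b′ (inj₂ b′≢b))) (*-zeroˡ (g (i ∸ a) (j ∸ b′)))) ⟩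
      mono c a b a b * g (i ∸ a) (j ∸ b)             ≡⟨ cong (_* g (i ∸ a) (j ∸ b)) (mono-hit c a b) ⟩
      c * g (i ∸ a) (j ∸ b)                          ∎

  tx≈ : tₛ *ₛ xₛ ≈ₛ mono (+ 1) 1 1
  tx≈ zero    j = *ₛ-mono tₛ (+ 1) 1 0 zero j
  tx≈ (suc i) j = trans (*ₛ-mono tₛ (+ 1) 1 0 (suc i) j) (*-identityʳ (tₛ i j))

  x²≈ : xₛ *ₛ xₛ ≈ₛ mono (+ 1) 2 0
  x²≈ zero    j = *ₛ-mono xₛ (+ 1) 1 0 zero j
  x²≈ (suc i) j = trans (*ₛ-mono xₛ (+ 1) 1 0 (suc i) j) (*-identityʳ (xₛ i j))

  *ₛ-oneₛ : ∀ f i j → (f *ₛ oneₛ) i j ≡ f i j * + 1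
  *ₛ-oneₛ f = *ₛ-mono f (+ 1) 0 0

  -- The inverses u and v, and the right-hand side

  band : ℕ → (ℕ → ℤ) → Series
  band s w i j = if i ≡ᵇ s ℕ.+ j then w j else + 0

  band-hit : ∀ s w j → band s w (s ℕ.+ j) j ≡ w j
  band-hit s w j with s ℕ.+ j ≡ᵇ s ℕ.+ j | ℕ.≡⇒≡ᵇ (s ℕ.+ j) (s ℕ.+ j) refl
  ... | true | _ = refl

  band-miss : ∀ s w i j → i ≢ s ℕ.+ j → band s w i j ≡ + 0
  band-miss s w i j i≢ with i ≡ᵇ s ℕ.+ j in eq
  ... | false = refl
  ... | true  = contradiction (ℕ.≡ᵇ⇒≡ i _ (subst T (sym eq) tt)) i≢

  column : (ℕ → ℤ) → Series
  column h i zero    = h i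
  column h i (suc j) = + 0

  -- The coefficients of 1/(1 − 3x + x²): the Fibonacci numbers F₂, F₄, F₆, …
  evenFib : ℕ → ℤ
  evenFib zero          = + 1
  evenFib (suc zero)    = + 3
  evenFib (suc (suc i)) = + 3 * evenFib (suc i) - evenFib i

  inverse-1-tx : ∀ u → u *ₛ (oneₛ -ₛ tₛ *ₛ xₛ) ≈ₛ oneₛ → u ≈ₛ band 0 (λ _ → + 1)
  inverse-1-tx u hu = u≈
    where
    recurrence : ∀ i j → u i j ≡ oneₛ i j + shift 1 1 (λ i j → u i j * + 1) i j
    recurrence i j = solve (begin
      u i j * + 1 - shift 1 1 (λ i j → u i j * + 1) i j
        ≡⟨ cong₂ _-_ (*ₛ-oneₛ u i j) (trans (*ₛ-cong {u} {u} (λ _ _ → refl) tx≈ i j) (*ₛ-mono u (+ 1) 1 1 i j)) ⟨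
      (u *ₛ oneₛ) i j - (u *ₛ (tₛ *ₛ xₛ)) i j
        ≡⟨ *ₛ-distribˡ-- u oneₛ (tₛ *ₛ xₛ) i j ⟨
      (u *ₛ (oneₛ -ₛ tₛ *ₛ xₛ)) i j
        ≡⟨ hu i j ⟩
      oneₛ i j ∎)
      where
      open ≡-Reasoning
      solve : ∀ {x y z} → x * + 1 - y ≡ z → x ≡ z + y
      solve {x} {y} refl = identity x y
        where
        identity : ∀ x y → x ≡ x * + 1 - y + y
        identity = solve-∀
    u≈ : u ≈ₛ band 0 (λ _ → + 1)
    u≈ zero    zero    = recurrence 0 0
    u≈ zero    (suc j) = recurrence 0 (suc j)
    u≈ (suc i) zero    = recurrence (suc i) 0
    u≈ (suc i) (suc j) = trans (recurrence (suc i) (suc j)) (trans (+-identityˡ _) (trans (*-identityʳ (u i j)) (u≈ i j)))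

  inverse-1-3x+x² : ∀ v → v *ₛ (oneₛ -ₛ mono (+ 3) 1 0 +ₛ xₛ *ₛ xₛ) ≈ₛ oneₛ → v ≈ₛ column evenFib
  inverse-1-3x+x² v hv = v≈
    where
    v₁ = λ i j → v i j * + 1
    v₃ = λ i j → v i j * + 3
    recurrence : ∀ i j → v i j ≡ oneₛ i j + shift 1 0 v₃ i j - shift 2 0 v₁ i j
    recurrence i j = solve (begin
      v i j * + 1 - shift 1 0 v₃ i j + shift 2 0 v₁ i j
        ≡⟨ cong₂ _+_ (cong₂ _-_ (*ₛ-oneₛ v i j) (*ₛ-mono v (+ 3) 1 0 i j)) (trans (*ₛ-cong {v} {v} (λ _ _ → refl) x²≈ i j) (*ₛ-mono v (+ 1) 2 0 i j)) ⟨
      (v *ₛ oneₛ) i j - (v *ₛ mono (+ 3) 1 0) i j + (v *ₛ (xₛ *ₛ xₛ)) i j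
        ≡⟨ cong (_+ (v *ₛ (xₛ *ₛ xₛ)) i j) (*ₛ-distribˡ-- v oneₛ (mono (+ 3) 1 0) i j) ⟨
      (v *ₛ (oneₛ -ₛ mono (+ 3) 1 0)) i j + (v *ₛ (xₛ *ₛ xₛ)) i j
        ≡⟨ *ₛ-distribˡ-+ v (oneₛ -ₛ mono (+ 3) 1 0) (xₛ *ₛ xₛ) i j ⟨
      (v *ₛ (oneₛ -ₛ mono (+ 3) 1 0 +ₛ xₛ *ₛ xₛ)) i j
        ≡⟨ hv i j ⟩
      oneₛ i j ∎)
      where
      open ≡-Reasoning
      solve : ∀ {x y z w} → x * + 1 - y + z ≡ w → x ≡ w + y - z
      solve {x} {y} {z} refl = identity x y z
        where
        identity : ∀ x y z → x ≡ x * + 1 - y + z + y - z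
        identity = solve-∀
    v≈ : v ≈ₛ column evenFib
    v≈ zero          zero    = recurrence 0 0
    v≈ zero          (suc j) = recurrence 0 (suc j)
    v≈ (suc zero)    j       = trans (recurrence 1 j) (trans (identity (v 0 j * + 3)) (trans (cong (_* + 3) (v≈ 0 j)) (step j)))
      where
      identity : ∀ x → + 0 + x - + 0 ≡ x
      identity = solve-∀
      step : ∀ j → column evenFib 0 j * + 3 ≡ column evenFib 1 j
      step zero    = refl
      step (suc j) = refl
    v≈ (suc (suc i)) j       = trans (recurrence (suc (suc i)) j)
      (trans (cong₂ (λ a b → oneₛ (suc (suc i)) j + a * + 3 - b * + 1) (v≈ (suc i) j) (v≈ i j)) (step j))
      where
      step : ∀ j → oneₛ (suc (suc i)) j + column evenFib (suc i) j * + 3 - column evenFib i j * + 1 ≡ column evenFib (suc (suc i)) j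
      step zero    = identity (evenFib (suc i)) (evenFib i)
        where
        identity : ∀ a b → + 0 + a * + 3 - b * + 1 ≡ + 3 * a - b
        identity = solve-∀
      step (suc j) = refl

  band-*ₛ-x : ∀ s w → band s w *ₛ xₛ ≈ₛ band (suc s) w
  band-*ₛ-x s w zero    j = *ₛ-mono (band s w) (+ 1) 1 0 zero j
  band-*ₛ-x s w (suc i) j = trans (*ₛ-mono (band s w) (+ 1) 1 0 (suc i) j) (*-identityʳ (band s w i j))

  band-*ₛ-x² : ∀ s w → band s w *ₛ (xₛ *ₛ xₛ) ≈ₛ band (2 ℕ.+ s) w
  band-*ₛ-x² s w i j = trans (*ₛ-cong {band s w} {band s w} (λ _ _ → refl) x²≈ i j) (shifted i)
    where
    shifted : ∀ i → (band s w *ₛ mono (+ 1) 2 0) i j ≡ band (2 ℕ.+ s) w i j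
    shifted zero          = *ₛ-mono (band s w) (+ 1) 2 0 zero j
    shifted (suc zero)    = *ₛ-mono (band s w) (+ 1) 2 0 1 j
    shifted (suc (suc i)) = trans (*ₛ-mono (band s w) (+ 1) 2 0 (suc (suc i)) j) (*-identityʳ (band s w i j))

  band₀-*ₛ-band₀ : ∀ w → band 0 w *ₛ band 0 (λ _ → + 1) ≈ₛ band 0 (λ j → ∑ (suc j) w)
  band₀-*ₛ-band₀ w i j with i ℕ.≟ j
  ... | yes refl = begin
    (band 0 w *ₛ U) i i                      ≡⟨ *ₛ-coefficient (band 0 w) U i i ⟩
    ∑ (suc i) (λ a → ∑ (suc i) (term a))     ≡⟨ ∑-cong (suc i) (λ a a<1+i → diagonal a (s≤s⁻¹ a<1+i)) ⟩
    ∑ (suc i) w                              ≡⟨ band-hit 0 (λ j → ∑ (suc j) w) i ⟨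
    band 0 (λ j → ∑ (suc j) w) i i           ∎
    where
    open ≡-Reasoning
    U = band 0 (λ _ → + 1)
    term = λ a b → band 0 w a b * U (i ∸ a) (i ∸ b)
    diagonal : ∀ a → a ≤ i → ∑ (suc i) (term a) ≡ w a
    diagonal a a≤i = begin
      ∑ (suc i) (term a)                     ≡⟨ ∑-single (suc i) (term a) a (s≤s a≤i) (λ b _ b≢a →
                                                  trans (cong (_* U (i ∸ a) (i ∸ b)) (band-miss 0 w a b (b≢a ∘ sym))) (*-zeroˡ (U (i ∸ a) (i ∸ b)))) ⟩
      band 0 w a a * U (i ∸ a) (i ∸ a)       ≡⟨ cong₂ _*_ (band-hit 0 w a) (band-hit 0 (λ _ → + 1) (i ∸ a)) ⟩
      w a * + 1                              ≡⟨ *-identityʳ (w a) ⟩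
      w a                                    ∎
  ... | no i≢j = trans (*ₛ-coefficient (band 0 w) U i j)
      (trans (∑-zero (suc i) (λ a → ∑ (suc j) (term a)) (λ a a<1+i → ∑-zero (suc j) (term a) (λ b b<1+j → vanish a b (s≤s⁻¹ a<1+i) (s≤s⁻¹ b<1+j))))
             (sym (band-miss 0 (λ j → ∑ (suc j) w) i j i≢j)))
    where
    U = band 0 (λ _ → + 1)
    term = λ a b → band 0 w a b * U (i ∸ a) (j ∸ b)
    vanish : ∀ a b → a ≤ i → b ≤ j → term a b ≡ + 0
    vanish a b a≤i b≤j with a ℕ.≟ b
    ... | no a≢b  = trans (cong (_* U (i ∸ a) (j ∸ b)) (band-miss 0 w a b a≢b)) (*-zeroˡ (U (i ∸ a) (j ∸ b)))
    ... | yes refl = trans (cong (band 0 w a a *_) (band-miss 0 (λ _ → + 1) (i ∸ a) (j ∸ a) (i≢j ∘ ℕ.∸-cancelʳ-≡ a≤i b≤j))) (*-zeroʳ (band 0 w a a))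

  *ₛ-column : ∀ f h i j → (f *ₛ column h) i j ≡ ∑ (suc i) (λ a → f a j * h (i ∸ a))
  *ₛ-column f h i j = trans (*ₛ-coefficient f (column h) i j) (∑-cong (suc i) (λ a _ → at-j a))
    where
    term = λ a b → f a b * column h (i ∸ a) (j ∸ b)
    at-j : ∀ a → ∑ (suc j) (term a) ≡ f a j * h (i ∸ a)
    at-j a = trans (∑-single (suc j) (term a) j ℕ.≤-refl (λ b b<1+j b≢j → vanish b (s≤s⁻¹ b<1+j) b≢j))
                   (cong (λ k → f a j * column h (i ∸ a) k) (ℕ.n∸n≡0 j))
      where
      vanish : ∀ b → b ≤ j → b ≢ j → term a b ≡ + 0
      vanish b b≤j b≢j with j ∸ b in eq
      ... | suc _ = *-zeroʳ (f a b)
      ... | zero  = contradiction (ℕ.≤-antisym b≤j (ℕ.m∸n≡0⇒m≤n eq)) b≢j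

  ∑-band-in : ∀ s w (h : ℕ → ℤ) i j → s ℕ.+ j ≤ i → ∑ (suc i) (λ a → band s w a j * h (i ∸ a)) ≡ w j * h (i ∸ (s ℕ.+ j))
  ∑-band-in s w h i j s+j≤i =
    trans (∑-single (suc i) term (s ℕ.+ j) (s≤s s+j≤i) (λ a _ a≢ → trans (cong (_* h (i ∸ a)) (band-miss s w a j a≢)) (*-zeroˡ (h (i ∸ a)))))
          (cong (_* h (i ∸ (s ℕ.+ j))) (band-hit s w j))
    where term = λ a → band s w a j * h (i ∸ a)

  ∑-band-out : ∀ s w (h : ℕ → ℤ) i j → i < s ℕ.+ j → ∑ (suc i) (λ a → band s w a j * h (i ∸ a)) ≡ + 0
  ∑-band-out s w h i j i<s+j = ∑-zero (suc i) (λ a → band s w a j * h (i ∸ a)) (λ a a<1+i →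
    trans (cong (_* h (i ∸ a)) (band-miss s w a j (λ a≡ → ℕ.<⇒≱ i<s+j (subst (_≤ i) a≡ (s≤s⁻¹ a<1+i))))) (*-zeroˡ (h (i ∸ a))))

  positive : ℕ → ℤ
  positive zero    = + 0
  positive (suc _) = + 1

  ∑-positive : ∀ j → ∑ (suc j) positive ≡ + j
  ∑-positive j = trans (+-identityˡ (∑ j (λ _ → + 1))) (ones j)
    where
    ones : ∀ n → ∑ n (λ _ → + 1) ≡ + n
    ones zero    = refl
    ones (suc n) = cong (λ z → + 1 + z) (ones n)

  band-cong : ∀ s {w w′} → (∀ j → w j ≡ w′ j) → band s w ≈ₛ band s w′
  band-cong s {w} {w′} w≗w′ i j = cong (if i ≡ᵇ s ℕ.+ j then_else + 0) (w≗w′ j)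

  toℤ : ℕ → ℤ
  toℤ n = + n

  rhs-coefficient : ∀ u v → u ≈ₛ band 0 (λ _ → + 1) → v ≈ₛ column evenFib → ∀ i j →
    (tₛ *ₛ xₛ *ₛ u +ₛ tₛ *ₛ xₛ *ₛ u *ₛ u *ₛ (xₛ -ₛ xₛ *ₛ xₛ) *ₛ v) i j
      ≡ band 0 positive i j + (∑ (suc i) (λ a → band 1 toℤ a j * evenFib (i ∸ a)) - ∑ (suc i) (λ a → band 2 toℤ a j * evenFib (i ∸ a)))
  rhs-coefficient u v u≈ v≈ i j = cong₂ _+_ (txu≈ i j) (begin
    (tₛ *ₛ xₛ *ₛ u *ₛ u *ₛ (xₛ -ₛ xₛ *ₛ xₛ) *ₛ v) i j
      ≡⟨ *ₛ-cong txuu[x-x²]≈ v≈ i j ⟩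
    ((band 1 toℤ -ₛ band 2 toℤ) *ₛ column evenFib) i j
      ≡⟨ *ₛ-column (band 1 toℤ -ₛ band 2 toℤ) evenFib i j ⟩
    ∑ (suc i) (λ a → (band 1 toℤ a j - band 2 toℤ a j) * evenFib (i ∸ a))
      ≡⟨ ∑-cong (suc i) (λ a _ → *-distribʳ-- (band 1 toℤ a j) (band 2 toℤ a j) (evenFib (i ∸ a))) ⟩
    ∑ (suc i) (λ a → band 1 toℤ a j * evenFib (i ∸ a) - band 2 toℤ a j * evenFib (i ∸ a))
      ≡⟨ ∑-- (suc i) (λ a → band 1 toℤ a j * evenFib (i ∸ a)) (λ a → band 2 toℤ a j * evenFib (i ∸ a)) ⟩
    ∑ (suc i) (λ a → band 1 toℤ a j * evenFib (i ∸ a)) - ∑ (suc i) (λ a → band 2 toℤ a j * evenFib (i ∸ a)) ∎)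
    where
    open ≡-Reasoning
    *-distribʳ-- : ∀ x y z → (x - y) * z ≡ x * z - y * z
    *-distribʳ-- = solve-∀
    refl≈ : ∀ {f} → f ≈ₛ f
    refl≈ _ _ = refl
    txu≈ : tₛ *ₛ xₛ *ₛ u ≈ₛ band 0 positive
    txu≈ i j = trans (*ₛ-cong tx≈ u≈ i j) (trans (mono-*ₛ (+ 1) 1 1 (band 0 (λ _ → + 1)) i j) (shifted i j))
      where
      shifted : ∀ i j → shift 1 1 (λ i j → + 1 * band 0 (λ _ → + 1) i j) i j ≡ band 0 positive i j
      shifted zero    zero    = refl
      shifted zero    (suc j) = refl
      shifted (suc i) zero    = refl
      shifted (suc i) (suc j) = *-identityˡ (band 0 (λ _ → + 1) i j)
    txuu≈ : tₛ *ₛ xₛ *ₛ u *ₛ u ≈ₛ band 0 toℤ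
    txuu≈ i j = trans (*ₛ-cong txu≈ u≈ i j) (trans (band₀-*ₛ-band₀ positive i j) (band-cong 0 ∑-positive i j))
    txuu[x-x²]≈ : tₛ *ₛ xₛ *ₛ u *ₛ u *ₛ (xₛ -ₛ xₛ *ₛ xₛ) ≈ₛ band 1 toℤ -ₛ band 2 toℤ
    txuu[x-x²]≈ i j = trans (*ₛ-cong {g = xₛ -ₛ xₛ *ₛ xₛ} txuu≈ refl≈ i j)
      (trans (*ₛ-distribˡ-- (band 0 toℤ) xₛ (xₛ *ₛ xₛ) i j) (cong₂ _-_ (band-*ₛ-x 0 toℤ i j) (band-*ₛ-x² 0 toℤ i j)))

  -- Comparing coefficients

  evenFibPrev : ℕ → ℤ
  evenFibPrev zero    = + 0
  evenFibPrev (suc m) = evenFib m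

  count≡evenFib-difference : ∀ m → + count (suc m) ≡ evenFib m - evenFibPrev m
  count≡evenFib-difference zero          = refl
  count≡evenFib-difference (suc zero)    = refl
  count≡evenFib-difference (suc (suc m)) = begin
    + count (3 ℕ.+ m)                                 ≡⟨ solve-for {+ count (3 ℕ.+ m)} {+ count (1 ℕ.+ m)} {+ count (2 ℕ.+ m)}
                                                           (trans (sym (pos-+ (count (3 ℕ.+ m)) (count (1 ℕ.+ m))))
                                                                  (trans (cong +_ (count-recurrence m)) (pos-* 3 (count (2 ℕ.+ m))))) ⟩
    + 3 * + count (2 ℕ.+ m) - + count (1 ℕ.+ m)       ≡⟨ cong₂ (λ c₂ c₁ → + 3 * c₂ - c₁) (count≡evenFib-difference (suc m)) (count≡evenFib-difference m) ⟩
    + 3 * (evenFib (suc m) - evenFib m) - (evenFib m - evenFibPrev m) ≡⟨ step m ⟩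
    evenFib (2 ℕ.+ m) - evenFib (suc m)               ∎
    where
    open ≡-Reasoning
    solve-for : ∀ {c₃ c₁ c₂} → c₃ + c₁ ≡ + 3 * c₂ → c₃ ≡ + 3 * c₂ - c₁
    solve-for {c₃} {c₁} e = trans (identity c₃ c₁) (cong (_- c₁) e)
      where
      identity : ∀ x y → x ≡ x + y - y
      identity = solve-∀
    step : ∀ m → + 3 * (evenFib (suc m) - evenFib m) - (evenFib m - evenFibPrev m) ≡ evenFib (2 ℕ.+ m) - evenFib (suc m)
    step zero    = refl
    step (suc m) = identity (evenFib m) (evenFib (suc m))
      where
      identity : ∀ a b → + 3 * ((+ 3 * b - a) - b) - (b - a) ≡ (+ 3 * (+ 3 * b - a) - b) - (+ 3 * b - a)
      identity = solve-∀

  diagonalSum : ℕ → ℕ → ℕ → ℤ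
  diagonalSum s i j = ∑ (suc i) (λ a → band s toℤ a j * evenFib (i ∸ a))

  gSeries-in : ∀ i j → 1 ≤ j → j ≤ i → gSeries i j ≡ + countK1 i j
  gSeries-in i (suc j) _ j≤i with suc j ≤ᵇ i | ℕ.≤⇒≤ᵇ j≤i
  ... | true | _ = refl

  gSeries-below : ∀ i j → i < j → gSeries i j ≡ + 0
  gSeries-below i (suc j) i<j with suc j ≤ᵇ i in eq
  ... | false = refl
  ... | true  = contradiction (ℕ.≤ᵇ⇒≤ (suc j) i (subst T (sym eq) tt)) (ℕ.<⇒≱ i<j)

  gSeries-coefficient : ∀ i j → gSeries i j ≡ band 0 positive i j + (diagonalSum 1 i j - diagonalSum 2 i j)
  gSeries-coefficient i j with ℕ.<-cmp i j
  ... | tri< i<j _ _ = trans (gSeries-below i j i<j) (sym (cong₂ (λ b t → b + t) (band-miss 0 positive i j (ℕ.<⇒≢ i<j))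
          (cong₂ _-_ (∑-band-out 1 toℤ evenFib i j (ℕ.m≤n⇒m≤1+n i<j)) (∑-band-out 2 toℤ evenFib i j (ℕ.m≤n⇒m≤1+n (ℕ.m≤n⇒m≤1+n i<j))))))
  gSeries-coefficient zero    zero    | tri≈ _ refl _ = refl
  gSeries-coefficient (suc j) (suc j) | tri≈ _ refl _ = trans (gSeries-in (suc j) (suc j) (s≤s z≤n) ℕ.≤-refl) (trans (cong +_ (countK1-last j))
    (sym (cong₂ (λ b t → b + t) (band-hit 0 positive (suc j))
          (cong₂ _-_ (∑-band-out 1 toℤ evenFib (suc j) (suc j) ℕ.≤-refl) (∑-band-out 2 toℤ evenFib (suc j) (suc j) (ℕ.n≤1+n _))))))
  gSeries-coefficient i zero | tri> _ _ 0<i = sym (cong₂ (λ b t → b + t) (band-miss 0 positive i 0 (ℕ.<⇒≢ 0<i ∘ sym))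
    (cong₂ _-_ (∑-zero (suc i) _ (λ a _ → at-zero 1 a)) (∑-zero (suc i) _ (λ a _ → at-zero 2 a))))
    where
    at-zero : ∀ s a → band s toℤ a 0 * evenFib (i ∸ a) ≡ + 0
    at-zero s a with a ≡ᵇ s ℕ.+ 0
    ... | true  = *-zeroˡ (evenFib (i ∸ a))
    ... | false = *-zeroˡ (evenFib (i ∸ a))
  gSeries-coefficient i (suc j) | tri> _ _ j<i = begin
    gSeries i (suc j)                                        ≡⟨ gSeries-in i (suc j) (s≤s z≤n) (ℕ.<⇒≤ j<i) ⟩
    + countK1 i (suc j)                                      ≡⟨ cong +_ (countK1≡k*count i (suc j) (s≤s z≤n) j<i) ⟩
    + (suc j ℕ.* count (i ∸ suc j))                          ≡⟨ pos-* (suc j) (count (i ∸ suc j)) ⟩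
    + suc j * + count (i ∸ suc j)                            ≡⟨ cong (λ c → + suc j * + count c) (ℕ.+-∸-assoc 1 j<i) ⟩
    + suc j * + count (suc m)                                ≡⟨ cong (+ suc j *_) (count≡evenFib-difference m) ⟩
    + suc j * (evenFib m - evenFibPrev m)                    ≡⟨ distribute (+ suc j) (evenFib m) (evenFibPrev m) ⟩
    + 0 + (+ suc j * evenFib m - + suc j * evenFibPrev m)    ≡⟨ cong₂ (λ b t → b + t) (band-miss 0 positive i (suc j) (ℕ.<⇒≢ j<i ∘ sym))
                                                                 (cong₂ _-_ (∑-band-in 1 toℤ evenFib i (suc j) j<i) second) ⟨
    band 0 positive i (suc j) + (diagonalSum 1 i (suc j) - diagonalSum 2 i (suc j)) ∎
    where
    open ≡-Reasoning
    m = i ∸ suc (suc j)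
    distribute : ∀ c a b → c * (a - b) ≡ + 0 + (c * a - c * b)
    distribute = solve-∀
    second : diagonalSum 2 i (suc j) ≡ + suc j * evenFibPrev m
    second with suc (suc (suc j)) ℕ.≤? i
    ... | yes 3+j≤i = trans (∑-band-in 2 toℤ evenFib i (suc j) 3+j≤i) (cong (λ k → + suc j * evenFibPrev k) (sym (ℕ.+-∸-assoc 1 3+j≤i)))
    ... | no 3+j≰i = trans (∑-band-out 2 toℤ evenFib i (suc j) (ℕ.≰⇒> 3+j≰i))
                           (sym (trans (cong (λ k → + suc j * evenFibPrev k) (ℕ.m≤n⇒m∸n≡0 (s≤s⁻¹ (ℕ.≰⇒> 3+j≰i)))) (*-zeroʳ (+ suc j))))


open import Defs
open import Data.Nat using (ℕ; _≤_; _<_; _*_; _∸_)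
open import Data.Product using (_×_; _,_)
open import Data.Integer using (+_)
open import Relation.Binary.PropositionalEquality using (_≡_; trans; sym)
open Permutations using (countK1≡k*count)
open GeneratingFunction using (inverse-1-tx; inverse-1-3x+x²; gSeries-coefficient; rhs-coefficient)

mainTheorem9 :
    ((n k : ℕ) → 1 ≤ k → k < n → countK1 n k ≡ k * count (n ∸ k))
    ×
    ((u v : Series) →
      u *ₛ (oneₛ -ₛ tₛ *ₛ xₛ) ≈ₛ oneₛ →
      v *ₛ (oneₛ -ₛ mono (+ 3) 1 0 +ₛ xₛ *ₛ xₛ) ≈ₛ oneₛ →
      gSeries ≈ₛ tₛ *ₛ xₛ *ₛ u +ₛ tₛ *ₛ xₛ *ₛ u *ₛ u *ₛ (xₛ -ₛ xₛ *ₛ xₛ) *ₛ v)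
mainTheorem9 = countK1≡k*count , λ u v hu hv i j →
  trans (gSeries-coefficient i j) (sym (rhs-coefficient u v (inverse-1-tx u hu) (inverse-1-3x+x² v hv) i j))
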